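{- Let $\Gamma$ be a ps-context and $i\in\mathbb N$. Then $\partial^-_i(\Gamma)$ and $\partial^+_i(\Gamma)$ are ps-contexts. Moreover, for any presentation of $G=G^\Gamma$ as a globular sum, there are isomorphisms of globular sets $\varphi^-:G^{\partial^-_i(\Gamma)}\to\partial_i G$ and $\varphi^+:G^{\partial^+_i(\Gamma)}\to\partial_i G$ such that $\sigma^G_i\circ\varphi^-$ is the inclusion $G^{\partial^-_i(\Gamma)}\to G^\Gamma$ and $\tau^G_i\circ\varphi^+$ is the inclusion $G^{\partial^+_i(\Gamma)}\to G^\Gamma$ (each sending a variable to itself).
   Context: Globular sets: sets $(G_n)_{n\in\mathbb N}$ with $s_n,t_n:G_{n+1}\to G_n$, $s_n s_{n+1}=s_n t_{n+1}$, $t_n s_{n+1}=t_n t_{n+1}$; morphisms commute with $s_n,t_n$. $D_n$ is the $n$-disk (cells $x_k^\pm$ for $k<n$ and $x_n$, with $s(x_{k+1}^\pm)=x_k^-$, $t(x_{k+1}^\pm)=x_k^+$, $s(x_n)=x_{n-1}^-$, $t(x_n)=x_{n-1}^+$); for $j\le i$, $\sigma^i_j,\tau^i_j:D_j\to D_i$ fix $x_k^\pm$ ($k<j$) and send $x_j$ to $x_j^-$, resp. $x_j^+$ (identities if $j=i$). A presentation of $G$ as a globular sum is a diagram $D_{i_0}\xleftarrow{\tau^{i_0}_{j_1}}D_{j_1}\xrightarrow{\sigma^{i_1}_{j_1}}D_{i_1}\leftarrow\cdots\leftarrow D_{j_k}\xrightarrow{\sigma^{i_k}_{j_k}}D_{i_k}$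 ($k\ge0$, $j_m\le\min(i_{m-1},i_m)$) together with a colimit cocone $\iota_m:D_{i_m}\to G$. Its $n$-boundary $\partial_nG$ is the colimit of the diagram obtained by replacing each $D_{i_m}$ by $D_{\min(i_m,n)}$, each $D_{j_m}$ by $D_{\min(j_m,n)}$ and the maps by $\tau^{\min(i_{m-1},n)}_{\min(j_m,n)}$, $\sigma^{\min(i_m,n)}_{\min(j_m,n)}$. The morphism $\sigma^G_n:\partial_nG\to G$ (resp. $\tau^G_n$) is the one induced by the maps $\iota_m\circ\sigma^{i_m}_{\min(i_m,n)}$ (resp. $\iota_m\circ\tau^{i_m}_{\min(i_m,n)}$) out of the disks $D_{\min(i_m,n)}$. Types over a countably infinite set of variables: $\star$ and $\mathrm{Hom}_A(t,u)$; $\dim\star=0$, $\dim\mathrm{Hom}_A(t,u)=\dim A+1$. Contexts are lists $x_1:A_1,\dots,x_n:A_n$. ps-contexts: judgments generated by $x:\star\vdash_{ps}x:\star$; from $\Gamma\vdash_{ps}x:A$ infer $\Gamma,y:A,f:\mathrm{Hom}_A(x,y)\vdash_{ps}f:\mathrm{Hom}_A(x,y)$ ($y,f$ not occurring in $\Gamma$); from $\Gamma\vdash_{ps}f:\mathrm{Hom}_A(x,y)$ infer $\Gamma\vdash_{ps}y:A$; from $\Gamma\vdash_{ps}x:\star$ infer $\Gamma\vdash_{ps}$; a ps-context is $\Gamma$ with $\Gamma\vdash_{ps}$. For a ps-context $\Gamma=(x_i:A_i)$, $G^\Gamma$ has $n$-cells the $x_i$ with $\dim A_i=n$, and $x_i$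 with $A_i=\mathrm{Hom}_B(y,z)$ has source $y$ and target $z$. The boundaries are defined recursively on contexts of the form $x:\star$ or $\Gamma,y:A,f:\mathrm{Hom}_A(x,y)$: $\partial^-_i(x:\star)=x:\star$; $\partial^-_i(\Gamma,y:A,f:\mathrm{Hom}_A(x,y))$ is $\partial^-_i(\Gamma)$ if $\dim A\ge i$ and $\partial^-_i(\Gamma),y:A,f:\mathrm{Hom}_A(x,y)$ otherwise; $\partial^+_i(x:\star)=x:\star$; $\partial^+_i(\Gamma,y:A,f:\mathrm{Hom}_A(x,y))$ is $\partial^+_i(\Gamma)$ if $\dim A>i$, is $\mathrm{drop}(\partial^+_i(\Gamma)),y:A$ if $\dim A=i$, and is $\partial^+_i(\Gamma),y:A,f:\mathrm{Hom}_A(x,y)$ if $\dim A<i$, where $\mathrm{drop}$ removes the last entry of a context. -}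

module Defs where

open import Data.Nat using (ℕ; zero; suc; _≤_; _<_; z≤n; s≤s; _⊓_)
open import Data.Nat.Properties using (_≟_; _≤?_; <-cmp; ⊓-monoˡ-≤; m⊓n≤m)
open import Data.Bool using (Bool; true; false; if_then_else_)
open import Data.Unit using (⊤; tt)
open import Data.Empty using (⊥; ⊥-elim)
open import Data.Maybe using (Maybe; just; nothing)
open import Data.Fin using (Fin; inject₁) renaming (suc to fsuc)
open import Data.Product using (Σ; _×_; _,_; proj₁; proj₂)
open import Relation.Binary.PropositionalEquality
open import Relation.Nullary using (¬_; yes; no; does)
open import Relation.Binary using (tri<; tri≈; tri>)

record GSet : Set₁ where
  field
    Cell : ℕ → Set
    src tgt : ∀ n → Cell (suc n) → Cell n
    glob-s : ∀ n (c : Cell (suc (suc n))) →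
             src n (src (suc n) c) ≡ src n (tgt (suc n) c)
    glob-t : ∀ n (c : Cell (suc (suc n))) →
             tgt n (src (suc n) c) ≡ tgt n (tgt (suc n) c)
open GSet public

record _⇒_ (G H : GSet) : Set where
  field
    map     : ∀ n → Cell G n → Cell H n
    map-src : ∀ n (c : Cell G (suc n)) → map n (src G n c) ≡ src H n (map (suc n) c)
    map-tgt : ∀ n (c : Cell G (suc n)) → map n (tgt G n c) ≡ tgt H n (map (suc n) c)
open _⇒_ public

idₘ : ∀ {G} → G ⇒ G
idₘ = record { map = λ _ c → c ; map-src = λ _ _ → refl ; map-tgt = λ _ _ → refl }

infixr 9 _∘ₘ_
_∘ₘ_ : ∀ {G H K} → H ⇒ K → G ⇒ H → G ⇒ K
g ∘ₘ f = record
  { map = λ n c → map g n (map f n c)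
  ; map-src = λ n c → trans (cong (map g n) (map-src f n c)) (map-src g n (map f (suc n) c))
  ; map-tgt = λ n c → trans (cong (map g n) (map-tgt f n c)) (map-tgt g n (map f (suc n) c))
  }

infix 4 _≈ₘ_
_≈ₘ_ : ∀ {G H} → G ⇒ H → G ⇒ H → Set
f ≈ₘ g = ∀ n c → map f n c ≡ map g n c

record Iso (G H : GSet) : Set where
  field
    to      : G ⇒ H
    from    : H ⇒ G
    from∘to : (from ∘ₘ to) ≈ₘ idₘ
    to∘from : (to ∘ₘ from) ≈ₘ idₘ
open Iso public

-- DCell n k is the set of k-cells of D_n:
--   k < n : Bool  (false = x_k^-, true = x_k^+)
--   k = n : ⊤     (tt = x_n)
--   k > n : ⊥
-- encoded by the recursion  D_{n+1} in dimension k+1  =  D_n in dimension k.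

DCell : ℕ → ℕ → Set
DCell zero    zero    = ⊤
DCell zero    (suc k) = ⊥
DCell (suc n) zero    = Bool
DCell (suc n) (suc k) = DCell n k

dsrc dtgt : ∀ n k → DCell n (suc k) → DCell n k
dsrc zero    k       ()
dsrc (suc n) zero    c = false
dsrc (suc n) (suc k) c = dsrc n k c
dtgt zero    k       ()
dtgt (suc n) zero    c = true
dtgt (suc n) (suc k) c = dtgt n k c

dglob-s : ∀ n k (c : DCell n (suc (suc k))) →
          dsrc n k (dsrc n (suc k) c) ≡ dsrc n k (dtgt n (suc k) c)
dglob-s zero    k       ()
dglob-s (suc n) zero    c = refl
dglob-s (suc n) (suc k) c = dglob-s n k c

dglob-t : ∀ n k (c : DCell n (suc (suc k))) →
          dtgt n k (dsrc n (suc k) c) ≡ dtgt n k (dtgt n (suc k) c)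
dglob-t zero    k       ()
dglob-t (suc n) zero    c = refl
dglob-t (suc n) (suc k) c = dglob-t n k c

D : ℕ → GSet
D n = record { Cell = DCell n ; src = dsrc n ; tgt = dtgt n
             ; glob-s = dglob-s n ; glob-t = dglob-t n }

-- σ^i_j and τ^i_j (j ≤ i): fix x_k^± for k < j, send x_j to x_j^- (resp. x_j^+),
-- identity when j = i.
dσ dτ : ∀ {j i} → j ≤ i → ∀ k → DCell j k → DCell i k
dσ {i = zero}  z≤n zero    c = c
dσ {i = suc i} z≤n zero    c = false
dσ             z≤n (suc k) ()
dσ (s≤s p) zero    c = c
dσ (s≤s p) (suc k) c = dσ p k c
dτ {i = zero}  z≤n zero    c = c
dτ {i = suc i} z≤n zero    c = true
dτ             z≤n (suc k) ()
dτ (s≤s p) zero    c = c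
dτ (s≤s p) (suc k) c = dτ p k c

dσ-src : ∀ {j i} (p : j ≤ i) k c → dσ p k (dsrc j k c) ≡ dsrc i k (dσ p (suc k) c)
dσ-src z≤n     k       ()
dσ-src (s≤s p) zero    c = refl
dσ-src (s≤s p) (suc k) c = dσ-src p k c

dσ-tgt : ∀ {j i} (p : j ≤ i) k c → dσ p k (dtgt j k c) ≡ dtgt i k (dσ p (suc k) c)
dσ-tgt z≤n     k       ()
dσ-tgt (s≤s p) zero    c = refl
dσ-tgt (s≤s p) (suc k) c = dσ-tgt p k c

dτ-src : ∀ {j i} (p : j ≤ i) k c → dτ p k (dsrc j k c) ≡ dsrc i k (dτ p (suc k) c)
dτ-src z≤n     k       ()
dτ-src (s≤s p) zero    c = refl
dτ-src (s≤s p) (suc k) c = dτ-src p k c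

dτ-tgt : ∀ {j i} (p : j ≤ i) k c → dτ p k (dtgt j k c) ≡ dtgt i k (dτ p (suc k) c)
dτ-tgt z≤n     k       ()
dτ-tgt (s≤s p) zero    c = refl
dτ-tgt (s≤s p) (suc k) c = dτ-tgt p k c

σᴰ τᴰ : ∀ {j i} → j ≤ i → D j ⇒ D i
σᴰ p = record { map = dσ p ; map-src = dσ-src p ; map-tgt = dσ-tgt p }
τᴰ p = record { map = dτ p ; map-src = dτ-src p ; map-tgt = dτ-tgt p }

-- Globular sums: zigzag diagrams
--   D_{i_0} <-τ- D_{j_1} -σ-> D_{i_1} <- ... <- D_{j_k} -σ-> D_{i_k}
-- top m = i_m (m = 0..k), mid m = j_{m+1} (m = 0..k-1).

record Zigzag : Set where
  field
    len   : ℕ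
    top   : Fin (suc len) → ℕ
    mid   : Fin len → ℕ
    mid≤l : ∀ m → mid m ≤ top (inject₁ m)
    mid≤r : ∀ m → mid m ≤ top (fsuc m)
open Zigzag public

record Cocone (Z : Zigzag) (X : GSet) : Set where
  field
    leg  : ∀ m → D (top Z m) ⇒ X
    comm : ∀ m → (leg (inject₁ m) ∘ₘ τᴰ (mid≤l Z m)) ≈ₘ (leg (fsuc m) ∘ₘ σᴰ (mid≤r Z m))
open Cocone public

IsColimit : (Z : Zigzag) (X : GSet) → Cocone Z X → Set₁
IsColimit Z X c =
  ∀ (Y : GSet) (d : Cocone Z Y) →
    Σ (X ⇒ Y) λ u → (∀ m → (u ∘ₘ leg c m) ≈ₘ leg d m)
                  × (∀ (u' : X ⇒ Y) → (∀ m → (u' ∘ₘ leg c m) ≈ₘ leg d m) → u' ≈ₘ u)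

record Presentation (G : GSet) : Set₁ where
  field
    diagram : Zigzag
    cocone  : Cocone diagram G
    colim   : IsColimit diagram G cocone
open Presentation public

trunc : ℕ → Zigzag → Zigzag
trunc n Z = record
  { len = len Z
  ; top = λ m → top Z m ⊓ n
  ; mid = λ m → mid Z m ⊓ n
  ; mid≤l = λ m → ⊓-monoˡ-≤ n (mid≤l Z m)
  ; mid≤r = λ m → ⊓-monoˡ-≤ n (mid≤r Z m)
  }

record Boundary (n : ℕ) {G : GSet} (P : Presentation G) : Set₁ where
  field
    obj    : GSet
    bcocone : Cocone (trunc n (diagram P)) obj
    bcolim  : IsColimit (trunc n (diagram P)) obj bcocone
open Boundary public

-- σ^G_n (resp. τ^G_n): the morphism ∂_n G → G induced by the maps
-- ι_m ∘ σ^{i_m}_{min(i_m,n)}  (resp. ι_m ∘ τ^{i_m}_{min(i_m,n)}),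
-- characterised by its composites with the colimit legs.
IsBoundarySrc : ∀ (n : ℕ) {G} (P : Presentation G) (B : Boundary n P) → obj B ⇒ G → Set
IsBoundarySrc n P B u =
  ∀ m → (u ∘ₘ leg (bcocone B) m) ≈ₘ
        (leg (cocone P) m ∘ₘ σᴰ (m⊓n≤m (top (diagram P) m) n))

IsBoundaryTgt : ∀ (n : ℕ) {G} (P : Presentation G) (B : Boundary n P) → obj B ⇒ G → Set
IsBoundaryTgt n P B u =
  ∀ m → (u ∘ₘ leg (bcocone B) m) ≈ₘ
        (leg (cocone P) m ∘ₘ τᴰ (m⊓n≤m (top (diagram P) m) n))

data Ty : Set where
  ⋆   : Ty
  Hom : Ty → ℕ → ℕ → Ty

dim : Ty → ℕ
dim ⋆           = zero
dim (Hom A _ _) = suc (dim A)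

infixl 5 _▸_∶_
data Ctx : Set where
  ∅     : Ctx
  _▸_∶_ : Ctx → ℕ → Ty → Ctx

data Fresh (y : ℕ) : Ctx → Set where
  fresh-∅ : Fresh y ∅
  fresh-▸ : ∀ {Γ x A} → Fresh y Γ → y ≢ x → Fresh y (Γ ▸ x ∶ A)

infix 3 _⊢ps_∶_
data _⊢ps_∶_ : Ctx → ℕ → Ty → Set where
  ps-start : ∀ x → (∅ ▸ x ∶ ⋆) ⊢ps x ∶ ⋆
  ps-ext   : ∀ {Γ x A y f} → Γ ⊢ps x ∶ A → Fresh y Γ → Fresh f Γ → y ≢ f →
             (Γ ▸ y ∶ A ▸ f ∶ Hom A x y) ⊢ps f ∶ Hom A x y
  ps-down  : ∀ {Γ f A x y} → Γ ⊢ps f ∶ Hom A x y → Γ ⊢ps y ∶ A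

data PsCtx (Γ : Ctx) : Set where
  ps : ∀ {x} → Γ ⊢ps x ∶ ⋆ → PsCtx Γ

drop : Ctx → Ctx
drop ∅           = ∅
drop (Γ ▸ _ ∶ _) = Γ

∂⁻ : ℕ → Ctx → Ctx
∂⁻ i ∅                     = ∅
∂⁻ i (∅ ▸ x ∶ A)           = ∅ ▸ x ∶ A
∂⁻ i (Γ ▸ y ∶ A ▸ f ∶ B)   =
  if does (i ≤? dim A) then ∂⁻ i Γ else (∂⁻ i Γ ▸ y ∶ A ▸ f ∶ B)

∂⁺ : ℕ → Ctx → Ctx
∂⁺ i ∅                   = ∅
∂⁺ i (∅ ▸ x ∶ A)         = ∅ ▸ x ∶ A
∂⁺ i (Γ ▸ y ∶ A ▸ f ∶ B) with <-cmp i (dim A)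
... | tri< _ _ _ = ∂⁺ i Γ
... | tri≈ _ _ _ = drop (∂⁺ i Γ) ▸ y ∶ A
... | tri> _ _ _ = ∂⁺ i Γ ▸ y ∶ A ▸ f ∶ B

typeOf : Ctx → ℕ → Maybe Ty
typeOf ∅           x = nothing
typeOf (Γ ▸ y ∶ A) x with x ≟ y
... | yes _ = just A
... | no _  = typeOf Γ x

WF : Ctx → Set
WF Γ = ∀ x B y z → typeOf Γ x ≡ just (Hom B y z) →
       typeOf Γ y ≡ just B × typeOf Γ z ≡ just B

VCell : Ctx → ℕ → Set
VCell Γ n = Σ ℕ λ x → Σ Ty λ A → typeOf Γ x ≡ just A × dim A ≡ n

private
  uip : ∀ {a} {X : Set a} {u v : X} (p q : u ≡ v) → p ≡ q
  uip refl refl = refl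

module _ {Γ : Ctx} (w : WF Γ) where
  vsrc vtgt : ∀ n → VCell Γ (suc n) → VCell Γ n
  vsrc n (x , ⋆         , e , ())
  vsrc n (x , Hom B y z , e , refl) = y , B , proj₁ (w x B y z e) , refl
  vtgt n (x , ⋆         , e , ())
  vtgt n (x , Hom B y z , e , refl) = z , B , proj₂ (w x B y z e) , refl

  vglob-s : ∀ n c → vsrc n (vsrc (suc n) c) ≡ vsrc n (vtgt (suc n) c)
  vglob-s n (x , ⋆ , e , ())
  vglob-s n (x , Hom ⋆ y z , e , ())
  vglob-s n (x , Hom (Hom C u v) y z , e , refl) =
    cong (λ p → u , C , p , refl) (uip _ _)

  vglob-t : ∀ n c → vtgt n (vsrc (suc n) c) ≡ vtgt n (vtgt (suc n) c)
  vglob-t n (x , ⋆ , e , ())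
  vglob-t n (x , Hom ⋆ y z , e , ())
  vglob-t n (x , Hom (Hom C u v) y z , e , refl) =
    cong (λ p → v , C , p , refl) (uip _ _)

  Gwf : GSet
  Gwf = record { Cell = VCell Γ ; src = vsrc ; tgt = vtgt
               ; glob-s = vglob-s ; glob-t = vglob-t }

private
  fresh⇒nothing : ∀ {y Γ} → Fresh y Γ → typeOf Γ y ≡ nothing
  fresh⇒nothing fresh-∅ = refl
  fresh⇒nothing {y} (fresh-▸ {x = x} fr ne) with y ≟ x
  ... | yes eq = ⊥-elim (ne eq)
  ... | no _   = fresh⇒nothing fr

  nothing≢just : ∀ {C : Ty} → nothing ≢ just C
  nothing≢just ()

  lift : ∀ {y Γ u C E} → Fresh y Γ → typeOf Γ u ≡ just C → typeOf (Γ ▸ y ∶ E) u ≡ just C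
  lift {y} {Γ} {u} fr e with u ≟ y
  ... | yes u≡y = ⊥-elim (nothing≢just (trans (sym (fresh⇒nothing fr)) (subst (λ v → typeOf Γ v ≡ _) u≡y e)))
  ... | no _ = e

  here : ∀ {Γ y A} → typeOf (Γ ▸ y ∶ A) y ≡ just A
  here {y = y} with y ≟ y
  ... | yes _ = refl
  ... | no ne = ⊥-elim (ne refl)

  wf-start : ∀ {x} → WF (∅ ▸ x ∶ ⋆)
  wf-start {x} z B u v e with z ≟ x
  wf-start {x} z B u v () | yes _
  wf-start {x} z B u v () | no _

  wf-ext : ∀ {Γ x A y f} → WF Γ → typeOf Γ x ≡ just A → Fresh y Γ → Fresh f Γ → y ≢ f →
           WF (Γ ▸ y ∶ A ▸ f ∶ Hom A x y)
  wf-ext {Γ} {x} {A} {y} {f} w tx fy ff y≢f z B u v e with z ≟ f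
  ... | yes refl with e
  ...   | refl = lift {f} {Γ ▸ y ∶ A} {x} {A} ff' (lift {y} {Γ} {x} {A} fy tx)
               , lift {f} {Γ ▸ y ∶ A} {y} {A} ff' (here {Γ} {y} {A})
    where ff' = fresh-▸ ff (λ eq → y≢f (sym eq))
  wf-ext {Γ} {x} {A} {y} {f} w tx fy ff y≢f z B u v e | no _ with z ≟ y
  ... | yes refl with e
  ...   | refl = lift {f} {Γ ▸ y ∶ A} {u} {B} ff' (lift {y} {Γ} {u} {B} fy (proj₁ (w x B u v tx)))
               , lift {f} {Γ ▸ y ∶ A} {v} {B} ff' (lift {y} {Γ} {v} {B} fy (proj₂ (w x B u v tx)))
    where ff' = fresh-▸ ff (λ eq → y≢f (sym eq))
  wf-ext {Γ} {x} {A} {y} {f} w tx fy ff y≢f z B u v e | no _ | no _ =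
    lift {f} {Γ ▸ y ∶ A} {u} {B} ff' (lift {y} {Γ} {u} {B} fy (proj₁ (w z B u v e)))
    , lift {f} {Γ ▸ y ∶ A} {v} {B} ff' (lift {y} {Γ} {v} {B} fy (proj₂ (w z B u v e)))
    where ff' = fresh-▸ ff (λ eq → y≢f (sym eq))

  inv : ∀ {Γ x A} → Γ ⊢ps x ∶ A → WF Γ × typeOf Γ x ≡ just A
  inv (ps-start x) = wf-start , here {∅} {x} {⋆}
  inv (ps-ext {Γ} {x} {A} {y} {f} d fy ff ne) =
    wf-ext (proj₁ (inv d)) (proj₂ (inv d)) fy ff ne , here {Γ ▸ y ∶ A} {f} {Hom A x y}
  inv (ps-down d) = proj₁ (inv d) , proj₂ (proj₁ (inv d) _ _ _ _ (proj₂ (inv d)))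

psWF : ∀ {Γ} → PsCtx Γ → WF Γ
psWF (ps d) = proj₁ (inv d)

G[_] : ∀ {Γ} → PsCtx Γ → GSet
G[_] {Γ} p = Gwf {Γ} (psWF p)

SendsVarsToThemselves : ∀ {Δ Γ} {p : PsCtx Δ} {q : PsCtx Γ} → G[ p ] ⇒ G[ q ] → Set
SendsVarsToThemselves {p = p} f = ∀ n (c : Cell G[ p ] n) → proj₁ (map f n c) ≡ proj₁ c

{-# OPTIONS --safe #-}

-- The i-boundary ∂ᵢG of a globular sum is the colimit of its diagram of disks with every D n
-- collapsed to D (n ⊓ i).  Collapsing is left adjoint to Degen i, which repeats the i-cells of a
-- globular set as identities in all higher dimensions: cocones of the collapsed diagram into Y
-- are cocones of the original diagram into Degen i Y, that is maps G^Γ ⇒ Degen i Y, and such a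
-- map identifies the two ends of every (i+1)-cell.
--
-- By induction on the derivation of Γ ⊢ps, ∂±ᵢΓ is a ps-context and there is a retraction ρ of
-- the variables of Γ onto those of ∂±ᵢΓ that fixes the variables of dimension below i, sends a
-- cell of dimension at least i to (a variable for) its i-dimensional source, resp. target, and
-- moves i-dimensional variables only along (i+1)-cells.  Through ρ every map G^Γ ⇒ Degen i Y
-- factors uniquely over G^∂±ᵢΓ, which is therefore a colimit of the collapsed diagram, hence
-- isomorphic to ∂ᵢG.  The legs of the presentation are jointly surjective and no variable of
-- ∂⁻ᵢΓ (resp. ∂⁺ᵢΓ) is the target (resp. source) of an (i+1)-cell; this forces σᴳᵢ ∘ φ⁻
-- (resp. τᴳᵢ ∘ φ⁺) to be the inclusion.

module Submission where

open import Defs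
open import Axiom.UniquenessOfIdentityProofs.WithK using (uip)
open import Data.Bool using (true; false; if_then_else_)
open import Data.Bool.Properties using (T-irrelevant)
open import Data.Empty using (⊥-elim)
open import Data.Fin using (Fin; inject₁) renaming (suc to fsuc)
open import Data.Fin.Properties using (any?)
open import Data.Maybe using (just; nothing)
open import Data.Maybe.Properties using (just-injective)
open import Data.Nat using (ℕ; zero; suc; _≤_; _<_; z≤n; s≤s; _⊓_)
open import Data.Nat.Properties
  using (_≟_; _≤?_; _<?_; <-cmp; ≤-reflexive; ≤-trans; ≤-antisym; ≤-pred; ≤-irrelevant; ≡-irrelevant;
         ≰⇒>; <⇒≤; <⇒≱; <⇒≢; <-irrefl; <-asym; n≤1+n; 1+n≢n; suc-injective; m≤n⇒m<n∨m≡n;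
         ⊓-monoˡ-≤; m⊓n≤m; m⊓n≤n)
open import Data.Product using (Σ; _×_; _,_; proj₁; proj₂)
open import Data.Sum using (_⊎_; inj₁; inj₂)
open import Data.Unit using (tt)
open import Relation.Binary using (tri<; tri≈; tri>)
open import Relation.Binary.PropositionalEquality
open import Relation.Nullary using (¬_; Dec; yes; no; does)
open import Relation.Nullary.Decidable using (True; toWitness; fromWitness; _⊎-dec_; dec-true; dec-false)

open ≡-Reasoning

shift : GSet → GSet
shift Y = record { Cell = λ k → Cell Y (suc k) ; src = λ k → src Y (suc k) ; tgt = λ k → tgt Y (suc k)
                 ; glob-s = λ k → glob-s Y (suc k) ; glob-t = λ k → glob-t Y (suc k) }

shiftₘ : ∀ {Y Z} → Y ⇒ Z → shift Y ⇒ shift Z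
shiftₘ f = record { map = λ k → map f (suc k) ; map-src = λ k → map-src f (suc k)
                   ; map-tgt = λ k → map-tgt f (suc k) }

-- Degen i Y has the k-cells of Y for k ≤ i and, in each dimension above i, a copy of the
-- i-cells of Y whose source and target are the cell itself.
DegCell : ℕ → GSet → ℕ → Set
DegCell zero    Y k       = Cell Y zero
DegCell (suc i) Y zero    = Cell Y zero
DegCell (suc i) Y (suc k) = DegCell i (shift Y) k

-- DegCell i Y 0 is Cell Y 0 for every i, but only after a case split on i.
fromDeg₀ : ∀ i Y → DegCell i Y 0 → Cell Y 0
fromDeg₀ zero    Y c = c
fromDeg₀ (suc i) Y c = c

toDeg₀ : ∀ i Y → Cell Y 0 → DegCell i Y 0
toDeg₀ zero    Y c = c
toDeg₀ (suc i) Y c = c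

fromDeg₀-toDeg₀ : ∀ i Y c → fromDeg₀ i Y (toDeg₀ i Y c) ≡ c
fromDeg₀-toDeg₀ zero    Y c = refl
fromDeg₀-toDeg₀ (suc i) Y c = refl

toDeg₀-fromDeg₀ : ∀ i Y c → toDeg₀ i Y (fromDeg₀ i Y c) ≡ c
toDeg₀-fromDeg₀ zero    Y c = refl
toDeg₀-fromDeg₀ (suc i) Y c = refl

degSrc degTgt : ∀ i Y k → DegCell i Y (suc k) → DegCell i Y k
degSrc zero    Y k       c = c
degSrc (suc i) Y zero    c = src Y 0 (fromDeg₀ i (shift Y) c)
degSrc (suc i) Y (suc k) c = degSrc i (shift Y) k c
degTgt zero    Y k       c = c
degTgt (suc i) Y zero    c = tgt Y 0 (fromDeg₀ i (shift Y) c)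
degTgt (suc i) Y (suc k) c = degTgt i (shift Y) k c

-- The suc k clauses come first so that shift (Degen (suc i) Y) is definitionally Degen i (shift Y).
degGlob-s : ∀ i Y k c → degSrc i Y k (degSrc i Y (suc k) c) ≡ degSrc i Y k (degTgt i Y (suc k) c)
degGlob-s zero          Y k       c = refl
degGlob-s (suc i)       Y (suc k) c = degGlob-s i (shift Y) k c
degGlob-s (suc zero)    Y zero    c = refl
degGlob-s (suc (suc i)) Y zero    c = glob-s Y 0 (fromDeg₀ i _ c)

degGlob-t : ∀ i Y k c → degTgt i Y k (degSrc i Y (suc k) c) ≡ degTgt i Y k (degTgt i Y (suc k) c)
degGlob-t zero          Y k       c = refl
degGlob-t (suc i)       Y (suc k) c = degGlob-t i (shift Y) k c
degGlob-t (suc zero)    Y zero    c = refl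
degGlob-t (suc (suc i)) Y zero    c = glob-t Y 0 (fromDeg₀ i _ c)

Degen : ℕ → GSet → GSet
Degen i Y = record { Cell = DegCell i Y ; src = degSrc i Y ; tgt = degTgt i Y
                   ; glob-s = degGlob-s i Y ; glob-t = degGlob-t i Y }

degSrc≡degTgt : ∀ i Y c → degSrc i Y i c ≡ degTgt i Y i c
degSrc≡degTgt zero    Y c = refl
degSrc≡degTgt (suc i) Y c = degSrc≡degTgt i (shift Y) c

degMap : ∀ i {Y Z} → Y ⇒ Z → ∀ k → DegCell i Y k → DegCell i Z k
degMap zero    f k       c = map f 0 c
degMap (suc i) f zero    c = map f 0 c
degMap (suc i) f (suc k) c = degMap i (shiftₘ f) k c

degMap-src : ∀ i {Y Z} (f : Y ⇒ Z) k c → degMap i f k (degSrc i Y k c) ≡ degSrc i Z k (degMap i f (suc k) c)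
degMap-src zero          f k       c = refl
degMap-src (suc zero)    f zero    c = map-src f 0 c
degMap-src (suc (suc i)) f zero    c = map-src f 0 c
degMap-src (suc i)       f (suc k) c = degMap-src i (shiftₘ f) k c

degMap-tgt : ∀ i {Y Z} (f : Y ⇒ Z) k c → degMap i f k (degTgt i Y k c) ≡ degTgt i Z k (degMap i f (suc k) c)
degMap-tgt zero          f k       c = refl
degMap-tgt (suc zero)    f zero    c = map-tgt f 0 c
degMap-tgt (suc (suc i)) f zero    c = map-tgt f 0 c
degMap-tgt (suc i)       f (suc k) c = degMap-tgt i (shiftₘ f) k c

Degenₘ : ∀ i {Y Z} → Y ⇒ Z → Degen i Y ⇒ Degen i Z
Degenₘ i f = record { map = degMap i f ; map-src = degMap-src i f ; map-tgt = degMap-tgt i f }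

degMap-toDeg₀ : ∀ i {Y Z} (f : Y ⇒ Z) c → degMap i f 0 (toDeg₀ i Y c) ≡ toDeg₀ i Z (map f 0 c)
degMap-toDeg₀ zero    f c = refl
degMap-toDeg₀ (suc i) f c = refl

low : ∀ i Y k → k ≤ i → Cell Y k → DegCell i Y k
low zero    Y zero    _       c = c
low (suc i) Y zero    _       c = c
low (suc i) Y (suc k) (s≤s p) c = low i (shift Y) k p c

low⁻¹ : ∀ i Y k → k ≤ i → DegCell i Y k → Cell Y k
low⁻¹ zero    Y zero    _       c = c
low⁻¹ (suc i) Y zero    _       c = c
low⁻¹ (suc i) Y (suc k) (s≤s p) c = low⁻¹ i (shift Y) k p c

low⁻¹-low : ∀ i Y k p c → low⁻¹ i Y k p (low i Y k p c) ≡ c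
low⁻¹-low zero    Y zero    z≤n     c = refl
low⁻¹-low (suc i) Y zero    p       c = refl
low⁻¹-low (suc i) Y (suc k) (s≤s p) c = low⁻¹-low i (shift Y) k p c

low-low⁻¹ : ∀ i Y k p c → low i Y k p (low⁻¹ i Y k p c) ≡ c
low-low⁻¹ zero    Y zero    z≤n     c = refl
low-low⁻¹ (suc i) Y zero    p       c = refl
low-low⁻¹ (suc i) Y (suc k) (s≤s p) c = low-low⁻¹ i (shift Y) k p c

fromDeg₀-low : ∀ i Y p c → fromDeg₀ i Y (low i Y 0 p c) ≡ c
fromDeg₀-low zero    Y z≤n c = refl
fromDeg₀-low (suc i) Y p   c = refl

low⁻¹≡fromDeg₀ : ∀ i Y p c → low⁻¹ i Y 0 p c ≡ fromDeg₀ i Y c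
low⁻¹≡fromDeg₀ zero    Y z≤n c = refl
low⁻¹≡fromDeg₀ (suc i) Y p   c = refl

low⁻¹-irrelevant : ∀ i Y k (p q : k ≤ i) c → low⁻¹ i Y k p c ≡ low⁻¹ i Y k q c
low⁻¹-irrelevant i Y k p q c = cong (λ r → low⁻¹ i Y k r c) (≤-irrelevant p q)

degSrc-low : ∀ i Y k (p : suc k ≤ i) (q : k ≤ i) c → degSrc i Y k (low i Y (suc k) p c) ≡ low i Y k q (src Y k c)
degSrc-low (suc i) Y zero    (s≤s p) q       c = cong (src Y 0) (fromDeg₀-low i (shift Y) p c)
degSrc-low (suc i) Y (suc k) (s≤s p) (s≤s q) c = degSrc-low i (shift Y) k p q c

degTgt-low : ∀ i Y k (p : suc k ≤ i) (q : k ≤ i) c → degTgt i Y k (low i Y (suc k) p c) ≡ low i Y k q (tgt Y k c)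
degTgt-low (suc i) Y zero    (s≤s p) q       c = cong (tgt Y 0) (fromDeg₀-low i (shift Y) p c)
degTgt-low (suc i) Y (suc k) (s≤s p) (s≤s q) c = degTgt-low i (shift Y) k p q c

low⁻¹-degSrc : ∀ i Y k (p : suc k ≤ i) (q : k ≤ i) c →
               low⁻¹ i Y k q (degSrc i Y k c) ≡ src Y k (low⁻¹ i Y (suc k) p c)
low⁻¹-degSrc i Y k p q c = begin
  low⁻¹ i Y k q (degSrc i Y k c)
    ≡⟨ cong (λ c → low⁻¹ i Y k q (degSrc i Y k c)) (sym (low-low⁻¹ i Y (suc k) p c)) ⟩
  low⁻¹ i Y k q (degSrc i Y k (low i Y (suc k) p (low⁻¹ i Y (suc k) p c)))
    ≡⟨ cong (low⁻¹ i Y k q) (degSrc-low i Y k p q _) ⟩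
  low⁻¹ i Y k q (low i Y k q (src Y k (low⁻¹ i Y (suc k) p c)))
    ≡⟨ low⁻¹-low i Y k q _ ⟩
  src Y k (low⁻¹ i Y (suc k) p c) ∎

low⁻¹-degTgt : ∀ i Y k (p : suc k ≤ i) (q : k ≤ i) c →
               low⁻¹ i Y k q (degTgt i Y k c) ≡ tgt Y k (low⁻¹ i Y (suc k) p c)
low⁻¹-degTgt i Y k p q c = begin
  low⁻¹ i Y k q (degTgt i Y k c)
    ≡⟨ cong (λ c → low⁻¹ i Y k q (degTgt i Y k c)) (sym (low-low⁻¹ i Y (suc k) p c)) ⟩
  low⁻¹ i Y k q (degTgt i Y k (low i Y (suc k) p (low⁻¹ i Y (suc k) p c)))
    ≡⟨ cong (low⁻¹ i Y k q) (degTgt-low i Y k p q _) ⟩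
  low⁻¹ i Y k q (low i Y k q (tgt Y k (low⁻¹ i Y (suc k) p c)))
    ≡⟨ low⁻¹-low i Y k q _ ⟩
  tgt Y k (low⁻¹ i Y (suc k) p c) ∎

low⁻¹-degMap : ∀ i {Y Z} (f : Y ⇒ Z) k p c → low⁻¹ i Z k p (degMap i f k c) ≡ map f k (low⁻¹ i Y k p c)
low⁻¹-degMap zero    f zero    z≤n     c = refl
low⁻¹-degMap (suc i) f zero    p       c = refl
low⁻¹-degMap (suc i) f (suc k) (s≤s p) c = low⁻¹-degMap i (shiftₘ f) k p c

high : ∀ i Y k → i ≤ k → Cell Y i → DegCell i Y k
high zero    Y k       _       c = c
high (suc i) Y (suc k) (s≤s p) c = high i (shift Y) k p c

degSrc-high : ∀ i Y k (p : i ≤ suc k) (q : i ≤ k) c → degSrc i Y k (high i Y (suc k) p c) ≡ high i Y k q c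
degSrc-high zero    Y k       p       q       c = refl
degSrc-high (suc i) Y (suc k) (s≤s p) (s≤s q) c = degSrc-high i (shift Y) k p q c

degTgt-high : ∀ i Y k (p : i ≤ suc k) (q : i ≤ k) c → degTgt i Y k (high i Y (suc k) p c) ≡ high i Y k q c
degTgt-high zero    Y k       p       q       c = refl
degTgt-high (suc i) Y (suc k) (s≤s p) (s≤s q) c = degTgt-high i (shift Y) k p q c

high≡low : ∀ i Y (p q : i ≤ i) c → high i Y i p c ≡ low i Y i q c
high≡low zero    Y z≤n     z≤n     c = refl
high≡low (suc i) Y (s≤s p) (s≤s q) c = high≡low i (shift Y) p q c

module IntoDegen {X Y : GSet} {i : ℕ}
  (below : ∀ k → k ≤ i → Cell X k → Cell Y k)
  (above : ∀ k → i ≤ k → Cell X k → Cell Y i)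
  (below-src : ∀ k (p : suc k ≤ i) (q : k ≤ i) c → below k q (src X k c) ≡ src Y k (below (suc k) p c))
  (below-tgt : ∀ k (p : suc k ≤ i) (q : k ≤ i) c → below k q (tgt X k c) ≡ tgt Y k (below (suc k) p c))
  (above-src : ∀ k (p : i ≤ suc k) (q : i ≤ k) c → above k q (src X k c) ≡ above (suc k) p c)
  (above-tgt : ∀ k (p : i ≤ suc k) (q : i ≤ k) c → above k q (tgt X k c) ≡ above (suc k) p c)
  (above≡below : ∀ (p q : i ≤ i) c → above i p c ≡ below i q c) where

  intoDegenMap : ∀ k → Cell X k → DegCell i Y k
  intoDegenMap k c with k ≤? i
  ... | yes p = low i Y k p (below k p c)
  ... | no ¬p = high i Y k (<⇒≤ (≰⇒> ¬p)) (above k (<⇒≤ (≰⇒> ¬p)) c)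

  intoDegen-low : ∀ k (p : k ≤ i) c → intoDegenMap k c ≡ low i Y k p (below k p c)
  intoDegen-low k p c with k ≤? i
  ... | yes p′ = cong (λ r → low i Y k r (below k r c)) (≤-irrelevant p′ p)
  ... | no ¬p = ⊥-elim (¬p p)

  intoDegen-high : ∀ k (p : i ≤ k) c → intoDegenMap k c ≡ high i Y k p (above k p c)
  intoDegen-high k p c with k ≤? i
  ... | yes q with ≤-antisym q p
  ...   | refl = trans (cong (low i Y i q) (sym (above≡below p q c))) (sym (high≡low i Y p q _))
  intoDegen-high k p c | no ¬p = cong (λ r → high i Y k r (above k r c)) (≤-irrelevant _ p)

  -- Split on an argument: a `with` would also abstract suc k ≤? i inside intoDegenMap (suc k).
  intoDegen-src : ∀ k c → intoDegenMap k (src X k c) ≡ degSrc i Y k (intoDegenMap (suc k) c)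
  intoDegen-src k c = by (suc k ≤? i)
    where
      by : Dec (suc k ≤ i) → intoDegenMap k (src X k c) ≡ degSrc i Y k (intoDegenMap (suc k) c)
      by (yes p) = begin
        intoDegenMap k (src X k c)
          ≡⟨ intoDegen-low k q _ ⟩
        low i Y k q (below k q (src X k c))
          ≡⟨ cong (low i Y k q) (below-src k p q c) ⟩
        low i Y k q (src Y k (below (suc k) p c))
          ≡⟨ sym (degSrc-low i Y k p q _) ⟩
        degSrc i Y k (low i Y (suc k) p (below (suc k) p c))
          ≡⟨ cong (degSrc i Y k) (sym (intoDegen-low (suc k) p c)) ⟩
        degSrc i Y k (intoDegenMap (suc k) c) ∎
        where q = ≤-trans (n≤1+n k) p
      by (no ¬p) = begin
        intoDegenMap k (src X k c)
          ≡⟨ intoDegen-high k q _ ⟩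
        high i Y k q (above k q (src X k c))
          ≡⟨ cong (high i Y k q) (above-src k p q c) ⟩
        high i Y k q (above (suc k) p c)
          ≡⟨ sym (degSrc-high i Y k p q _) ⟩
        degSrc i Y k (high i Y (suc k) p (above (suc k) p c))
          ≡⟨ cong (degSrc i Y k) (sym (intoDegen-high (suc k) p c)) ⟩
        degSrc i Y k (intoDegenMap (suc k) c) ∎
        where q = ≤-pred (≰⇒> ¬p)
              p = ≤-trans q (n≤1+n k)

  intoDegen-tgt : ∀ k c → intoDegenMap k (tgt X k c) ≡ degTgt i Y k (intoDegenMap (suc k) c)
  intoDegen-tgt k c = by (suc k ≤? i)
    where
      by : Dec (suc k ≤ i) → intoDegenMap k (tgt X k c) ≡ degTgt i Y k (intoDegenMap (suc k) c)
      by (yes p) = begin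
        intoDegenMap k (tgt X k c)
          ≡⟨ intoDegen-low k q _ ⟩
        low i Y k q (below k q (tgt X k c))
          ≡⟨ cong (low i Y k q) (below-tgt k p q c) ⟩
        low i Y k q (tgt Y k (below (suc k) p c))
          ≡⟨ sym (degTgt-low i Y k p q _) ⟩
        degTgt i Y k (low i Y (suc k) p (below (suc k) p c))
          ≡⟨ cong (degTgt i Y k) (sym (intoDegen-low (suc k) p c)) ⟩
        degTgt i Y k (intoDegenMap (suc k) c) ∎
        where q = ≤-trans (n≤1+n k) p
      by (no ¬p) = begin
        intoDegenMap k (tgt X k c)
          ≡⟨ intoDegen-high k q _ ⟩
        high i Y k q (above k q (tgt X k c))
          ≡⟨ cong (high i Y k q) (above-tgt k p q c) ⟩
        high i Y k q (above (suc k) p c)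
          ≡⟨ sym (degTgt-high i Y k p q _) ⟩
        degTgt i Y k (high i Y (suc k) p (above (suc k) p c))
          ≡⟨ cong (degTgt i Y k) (sym (intoDegen-high (suc k) p c)) ⟩
        degTgt i Y k (intoDegenMap (suc k) c) ∎
        where q = ≤-pred (≰⇒> ¬p)
              p = ≤-trans q (n≤1+n k)

  intoDegen : X ⇒ Degen i Y
  intoDegen = record { map = intoDegenMap ; map-src = intoDegen-src ; map-tgt = intoDegen-tgt }

fromDegen : ∀ {X Y i} → (∀ k → Cell X k → k ≤ i) → X ⇒ Degen i Y → X ⇒ Y
fromDegen {X} {Y} {i} bounded v = record
  { map     = λ k c → low⁻¹ i Y k (bounded k c) (map v k c)
  ; map-src = λ k c → trans (cong (low⁻¹ i Y k _) (map-src v k c)) (low⁻¹-degSrc i Y k (bounded (suc k) c) _ _)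
  ; map-tgt = λ k c → trans (cong (low⁻¹ i Y k _) (map-tgt v k c)) (low⁻¹-degTgt i Y k (bounded (suc k) c) _ _) }

-- Disks: maps D n ⇒ Degen i Y are maps D (n ⊓ i) ⇒ Y

shiftᴰ : ∀ {m Y} → D (suc m) ⇒ Y → D m ⇒ shift Y
shiftᴰ d = record { map = λ k → map d (suc k) ; map-src = λ k → map-src d (suc k)
                   ; map-tgt = λ k → map-tgt d (suc k) }

liftMap : ∀ n i {Y} → (∀ k → DCell (n ⊓ i) k → Cell Y k) → ∀ k → DCell n k → DegCell i Y k
liftMap zero i {Y} g zero tt = toDeg₀ i Y (g 0 tt)
liftMap zero i g (suc k) ()
liftMap (suc n) zero g k c = g 0 tt
liftMap (suc n) (suc i) g zero b = g 0 b
liftMap (suc n) (suc i) {Y} g (suc k) c = liftMap n i {shift Y} (λ k → g (suc k)) k c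

unliftMap : ∀ n i {Y} → (∀ k → DCell n k → DegCell i Y k) → ∀ k → DCell (n ⊓ i) k → Cell Y k
unliftMap zero i {Y} h zero tt = fromDeg₀ i Y (h 0 tt)
unliftMap zero i h (suc k) ()
unliftMap (suc n) zero h zero tt = h 0 false
unliftMap (suc n) zero h (suc k) ()
unliftMap (suc n) (suc i) h zero b = h 0 b
unliftMap (suc n) (suc i) {Y} h (suc k) c = unliftMap n i {shift Y} (λ k → h (suc k)) k c

collapse₀ : ∀ n i → DCell n 0 → DCell (n ⊓ i) 0
collapse₀ zero i tt = tt
collapse₀ (suc n) zero c = tt
collapse₀ (suc n) (suc i) b = b

σ₀ : ∀ n i → DCell (n ⊓ i) 0 → DCell n 0
σ₀ zero i tt = tt
σ₀ (suc n) zero tt = false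
σ₀ (suc n) (suc i) b = b

basepoint : ∀ n → DCell n 0
basepoint zero = tt
basepoint (suc n) = false

DCell-dim≤ : ∀ n k → DCell n k → k ≤ n
DCell-dim≤ zero    zero    c = z≤n
DCell-dim≤ (suc n) zero    c = z≤n
DCell-dim≤ (suc n) (suc k) c = s≤s (DCell-dim≤ n k c)

liftMap₀ : ∀ n i {Y} g c → fromDeg₀ i Y (liftMap n i {Y} g 0 c) ≡ g 0 (collapse₀ n i c)
liftMap₀ zero i {Y} g tt = fromDeg₀-toDeg₀ i Y _
liftMap₀ (suc n) zero g c = refl
liftMap₀ (suc n) (suc i) g c = refl

unliftMap₀ : ∀ n i {Y} h c → unliftMap n i {Y} h 0 c ≡ fromDeg₀ i Y (h 0 (σ₀ n i c))
unliftMap₀ zero i h tt = refl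
unliftMap₀ (suc n) zero h tt = refl
unliftMap₀ (suc n) (suc i) h c = refl

lift-src : ∀ n i {Y} (d : D (n ⊓ i) ⇒ Y) k c →
           liftMap n i (map d) k (dsrc n k c) ≡ degSrc i Y k (liftMap n i (map d) (suc k) c)
lift-src zero i d k ()
lift-src (suc n) zero d k c = refl
lift-src (suc n) (suc i) {Y} d zero c =
  trans (map-src d 0 (collapse₀ n i c)) (cong (src Y 0) (sym (liftMap₀ n i (map (shiftᴰ d)) c)))
lift-src (suc n) (suc i) d (suc k) c = lift-src n i (shiftᴰ d) k c

lift-tgt : ∀ n i {Y} (d : D (n ⊓ i) ⇒ Y) k c →
           liftMap n i (map d) k (dtgt n k c) ≡ degTgt i Y k (liftMap n i (map d) (suc k) c)
lift-tgt zero i d k ()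
lift-tgt (suc n) zero d k c = refl
lift-tgt (suc n) (suc i) {Y} d zero c =
  trans (map-tgt d 0 (collapse₀ n i c)) (cong (tgt Y 0) (sym (liftMap₀ n i (map (shiftᴰ d)) c)))
lift-tgt (suc n) (suc i) d (suc k) c = lift-tgt n i (shiftᴰ d) k c

lift : ∀ n i {Y} → D (n ⊓ i) ⇒ Y → D n ⇒ Degen i Y
lift n i d = record { map = liftMap n i (map d) ; map-src = lift-src n i d ; map-tgt = lift-tgt n i d }

unlift-src : ∀ n i {Y} (h : D n ⇒ Degen i Y) k c →
             unliftMap n i (map h) k (dsrc (n ⊓ i) k c) ≡ src Y k (unliftMap n i (map h) (suc k) c)
unlift-src zero i h k ()
unlift-src (suc n) zero h k ()
unlift-src (suc n) (suc i) {Y} h zero c =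
  trans (map-src h 0 (σ₀ n i c)) (cong (src Y 0) (sym (unliftMap₀ n i (map (shiftᴰ h)) c)))
unlift-src (suc n) (suc i) h (suc k) c = unlift-src n i (shiftᴰ h) k c

unlift-tgt : ∀ n i {Y} (h : D n ⇒ Degen i Y) k c →
             unliftMap n i (map h) k (dtgt (n ⊓ i) k c) ≡ tgt Y k (unliftMap n i (map h) (suc k) c)
unlift-tgt zero i h k ()
unlift-tgt (suc n) zero h k ()
unlift-tgt (suc n) (suc i) {Y} h zero c =
  trans (map-tgt h 0 (σ₀ n i c)) (cong (tgt Y 0) (sym (unliftMap₀ n i (map (shiftᴰ h)) c)))
unlift-tgt (suc n) (suc i) h (suc k) c = unlift-tgt n i (shiftᴰ h) k c

unlift : ∀ n i {Y} → D n ⇒ Degen i Y → D (n ⊓ i) ⇒ Y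
unlift n i h = record { map = unliftMap n i (map h) ; map-src = unlift-src n i h ; map-tgt = unlift-tgt n i h }

Degen₀-constant : ∀ n {Y} (h : D (suc n) ⇒ Degen 0 Y) k c → map h k c ≡ map h 0 false
Degen₀-constant n h zero false = refl
Degen₀-constant n {Y} h zero true = trans (map-tgt h 0 (basepoint n)) (sym (map-src h 0 (basepoint n)))
Degen₀-constant n {Y} h (suc k) c = trans (sym (map-src h k c)) (Degen₀-constant n {Y} h k _)

lift-unlift : ∀ n i {Y} (h : D n ⇒ Degen i Y) → lift n i (unlift n i h) ≈ₘ h
lift-unlift zero i {Y} h zero tt = toDeg₀-fromDeg₀ i Y _
lift-unlift zero i h (suc k) ()
lift-unlift (suc n) zero {Y} h k c = sym (Degen₀-constant n {Y} h k c)
lift-unlift (suc n) (suc i) h zero c = refl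
lift-unlift (suc n) (suc i) h (suc k) c = lift-unlift n i (shiftᴰ h) k c

unlift-lift : ∀ n i {Y} (d : D (n ⊓ i) ⇒ Y) → unlift n i (lift n i d) ≈ₘ d
unlift-lift zero i {Y} d zero tt = fromDeg₀-toDeg₀ i Y _
unlift-lift zero i d (suc k) ()
unlift-lift (suc n) zero d zero tt = refl
unlift-lift (suc n) zero d (suc k) ()
unlift-lift (suc n) (suc i) d zero c = refl
unlift-lift (suc n) (suc i) d (suc k) c = unlift-lift n i (shiftᴰ d) k c

liftMap-cong : ∀ n i {Y} (g g′ : ∀ k → DCell (n ⊓ i) k → Cell Y k) → (∀ k c → g k c ≡ g′ k c) →
             ∀ k c → liftMap n i {Y} g k c ≡ liftMap n i g′ k c
liftMap-cong zero i {Y} g g′ e zero tt = cong (toDeg₀ i Y) (e 0 tt)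
liftMap-cong zero i g g′ e (suc k) ()
liftMap-cong (suc n) zero g g′ e k c = e 0 tt
liftMap-cong (suc n) (suc i) g g′ e zero c = e 0 c
liftMap-cong (suc n) (suc i) g g′ e (suc k) c = liftMap-cong n i _ _ (λ k → e (suc k)) k c

unliftMap-cong : ∀ n i {Y} (h h′ : ∀ k → DCell n k → DegCell i Y k) → (∀ k c → h k c ≡ h′ k c) →
             ∀ k c → unliftMap n i {Y} h k c ≡ unliftMap n i h′ k c
unliftMap-cong zero i {Y} h h′ e zero tt = cong (fromDeg₀ i Y) (e 0 tt)
unliftMap-cong zero i h h′ e (suc k) ()
unliftMap-cong (suc n) zero h h′ e zero tt = e 0 false
unliftMap-cong (suc n) zero h h′ e (suc k) ()
unliftMap-cong (suc n) (suc i) h h′ e zero c = e 0 c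
unliftMap-cong (suc n) (suc i) h h′ e (suc k) c = unliftMap-cong n i _ _ (λ k → e (suc k)) k c

lift-natural : ∀ n i {Y Y′} (f : Y ⇒ Y′) (d : D (n ⊓ i) ⇒ Y) → (Degenₘ i f ∘ₘ lift n i d) ≈ₘ lift n i (f ∘ₘ d)
lift-natural zero i f d zero tt = degMap-toDeg₀ i f _
lift-natural zero i f d (suc k) ()
lift-natural (suc n) zero f d k c = refl
lift-natural (suc n) (suc i) f d zero c = refl
lift-natural (suc n) (suc i) f d (suc k) c = lift-natural n i (shiftₘ f) (shiftᴰ d) k c

lift-τᴰ : ∀ n i j (p : j ≤ n) (p′ : j ⊓ i ≤ n ⊓ i) {Y} (d : D (n ⊓ i) ⇒ Y) →
        (lift n i d ∘ₘ τᴰ p) ≈ₘ lift j i (d ∘ₘ τᴰ p′)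
lift-τᴰ zero i zero z≤n z≤n d zero tt = refl
lift-τᴰ (suc n) zero zero z≤n z≤n d zero tt = refl
lift-τᴰ (suc n) (suc i) zero z≤n z≤n d zero tt = refl
lift-τᴰ n i zero z≤n p′ d (suc k) ()
lift-τᴰ (suc n) zero (suc j) (s≤s p) z≤n d k c = refl
lift-τᴰ (suc n) (suc i) (suc j) (s≤s p) (s≤s p′) d zero c = refl
lift-τᴰ (suc n) (suc i) (suc j) (s≤s p) (s≤s p′) d (suc k) c = lift-τᴰ n i j p p′ (shiftᴰ d) k c

lift-σᴰ : ∀ n i j (p : j ≤ n) (p′ : j ⊓ i ≤ n ⊓ i) {Y} (d : D (n ⊓ i) ⇒ Y) →
        (lift n i d ∘ₘ σᴰ p) ≈ₘ lift j i (d ∘ₘ σᴰ p′)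
lift-σᴰ zero i zero z≤n z≤n d zero tt = refl
lift-σᴰ (suc n) zero zero z≤n z≤n d zero tt = refl
lift-σᴰ (suc n) (suc i) zero z≤n z≤n d zero tt = refl
lift-σᴰ n i zero z≤n p′ d (suc k) ()
lift-σᴰ (suc n) zero (suc j) (s≤s p) z≤n d k c = refl
lift-σᴰ (suc n) (suc i) (suc j) (s≤s p) (s≤s p′) d zero c = refl
lift-σᴰ (suc n) (suc i) (suc j) (s≤s p) (s≤s p′) d (suc k) c = lift-σᴰ n i j p p′ (shiftᴰ d) k c

low⁻¹-lift-σᴰ : ∀ n i {Y} (p : n ⊓ i ≤ n) (d : D (n ⊓ i) ⇒ Y) k (r : k ≤ i) e →
             low⁻¹ i Y k r (liftMap n i (map d) k (dσ p k e)) ≡ map d k e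
low⁻¹-lift-σᴰ zero i {Y} z≤n d zero r tt = trans (low⁻¹≡fromDeg₀ i Y r _) (fromDeg₀-toDeg₀ i Y _)
low⁻¹-lift-σᴰ zero i z≤n d (suc k) r ()
low⁻¹-lift-σᴰ (suc n) zero z≤n d zero z≤n tt = refl
low⁻¹-lift-σᴰ (suc n) (suc i) (s≤s p) d zero r e = refl
low⁻¹-lift-σᴰ (suc n) (suc i) (s≤s p) d (suc k) (s≤s r) e = low⁻¹-lift-σᴰ n i p (shiftᴰ d) k r e

low⁻¹-lift-τᴰ : ∀ n i {Y} (p : n ⊓ i ≤ n) (d : D (n ⊓ i) ⇒ Y) k (r : k ≤ i) e →
             low⁻¹ i Y k r (liftMap n i (map d) k (dτ p k e)) ≡ map d k e
low⁻¹-lift-τᴰ zero i {Y} z≤n d zero r tt = trans (low⁻¹≡fromDeg₀ i Y r _) (fromDeg₀-toDeg₀ i Y _)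
low⁻¹-lift-τᴰ zero i z≤n d (suc k) r ()
low⁻¹-lift-τᴰ (suc n) zero z≤n d zero z≤n tt = refl
low⁻¹-lift-τᴰ (suc n) (suc i) (s≤s p) d zero r e = refl
low⁻¹-lift-τᴰ (suc n) (suc i) (s≤s p) d (suc k) (s≤s r) e = low⁻¹-lift-τᴰ n i p (shiftᴰ d) k r e

σᴰ-covers : ∀ n i (p : n ⊓ i ≤ n) k (r : k ≤ i) (e : DCell n k) →
            (Σ (DCell (n ⊓ i) k) λ e′ → dσ p k e′ ≡ e) ⊎ (k ≡ i × Σ (DCell n (suc k)) λ c → dtgt n k c ≡ e)
σᴰ-covers zero i z≤n zero r tt = inj₁ (tt , refl)
σᴰ-covers zero i z≤n (suc k) r ()
σᴰ-covers (suc n) zero z≤n zero z≤n false = inj₁ (tt , refl)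
σᴰ-covers (suc n) zero z≤n zero z≤n true = inj₂ (refl , basepoint n , refl)
σᴰ-covers (suc n) (suc i) (s≤s p) zero r e = inj₁ (e , refl)
σᴰ-covers (suc n) (suc i) (s≤s p) (suc k) (s≤s r) e with σᴰ-covers n i p k r e
... | inj₁ (e′ , eq) = inj₁ (e′ , eq)
... | inj₂ (eq , c , eq′) = inj₂ (cong suc eq , c , eq′)

τᴰ-covers : ∀ n i (p : n ⊓ i ≤ n) k (r : k ≤ i) (e : DCell n k) →
            (Σ (DCell (n ⊓ i) k) λ e′ → dτ p k e′ ≡ e) ⊎ (k ≡ i × Σ (DCell n (suc k)) λ c → dsrc n k c ≡ e)
τᴰ-covers zero i z≤n zero r tt = inj₁ (tt , refl)
τᴰ-covers zero i z≤n (suc k) r ()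
τᴰ-covers (suc n) zero z≤n zero z≤n true = inj₁ (tt , refl)
τᴰ-covers (suc n) zero z≤n zero z≤n false = inj₂ (refl , basepoint n , refl)
τᴰ-covers (suc n) (suc i) (s≤s p) zero r e = inj₁ (e , refl)
τᴰ-covers (suc n) (suc i) (s≤s p) (suc k) (s≤s r) e with τᴰ-covers n i p k r e
... | inj₁ (e′ , eq) = inj₁ (e′ , eq)
... | inj₂ (eq , c , eq′) = inj₂ (cong suc eq , c , eq′)

unlift-τᴰ : ∀ n i j (p : j ≤ n) (p′ : j ⊓ i ≤ n ⊓ i) {Y} (h : D n ⇒ Degen i Y) →
          (unlift n i h ∘ₘ τᴰ p′) ≈ₘ unlift j i (h ∘ₘ τᴰ p)
unlift-τᴰ n i j p p′ h k c = begin
  map (unlift n i h ∘ₘ τᴰ p′) k c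
    ≡⟨ sym (unlift-lift j i (unlift n i h ∘ₘ τᴰ p′) k c) ⟩
  unliftMap j i (liftMap j i (map (unlift n i h ∘ₘ τᴰ p′))) k c
    ≡⟨ unliftMap-cong j i _ _ (λ k c → sym (lift-τᴰ n i j p p′ (unlift n i h) k c)) k c ⟩
  unliftMap j i (map (lift n i (unlift n i h) ∘ₘ τᴰ p)) k c
    ≡⟨ unliftMap-cong j i _ _ (λ k c → lift-unlift n i h k (dτ p k c)) k c ⟩
  map (unlift j i (h ∘ₘ τᴰ p)) k c ∎

unlift-σᴰ : ∀ n i j (p : j ≤ n) (p′ : j ⊓ i ≤ n ⊓ i) {Y} (h : D n ⇒ Degen i Y) →
          (unlift n i h ∘ₘ σᴰ p′) ≈ₘ unlift j i (h ∘ₘ σᴰ p)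
unlift-σᴰ n i j p p′ h k c = begin
  map (unlift n i h ∘ₘ σᴰ p′) k c
    ≡⟨ sym (unlift-lift j i (unlift n i h ∘ₘ σᴰ p′) k c) ⟩
  unliftMap j i (liftMap j i (map (unlift n i h ∘ₘ σᴰ p′))) k c
    ≡⟨ unliftMap-cong j i _ _ (λ k c → sym (lift-σᴰ n i j p p′ (unlift n i h) k c)) k c ⟩
  unliftMap j i (map (lift n i (unlift n i h) ∘ₘ σᴰ p)) k c
    ≡⟨ unliftMap-cong j i _ _ (λ k c → lift-unlift n i h k (dσ p k c)) k c ⟩
  map (unlift j i (h ∘ₘ σᴰ p)) k c ∎

unlift-via-σᴰ : ∀ n i {Y} (p : n ⊓ i ≤ n) (h : D n ⇒ Degen i Y) k (r : k ≤ i) e →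
            map (unlift n i h) k e ≡ low⁻¹ i Y k r (map h k (dσ p k e))
unlift-via-σᴰ n i {Y} p h k r e =
  trans (sym (low⁻¹-lift-σᴰ n i p (unlift n i h) k r e))
        (cong (low⁻¹ i Y k r) (lift-unlift n i h k (dσ p k e)))

postcompose : ∀ {Z X Y} → X ⇒ Y → Cocone Z X → Cocone Z Y
postcompose u c = record { leg = λ m → u ∘ₘ leg c m ; comm = λ m k e → cong (map u _) (comm c m k e) }

liftCocone : ∀ {Z Y} i → Cocone (trunc i Z) Y → Cocone Z (Degen i Y)
liftCocone {Z} {Y} i d = record { leg = λ m → lift (top Z m) i (leg d m) ; comm = commutes }
  where
    commutes : ∀ m → (lift (top Z (inject₁ m)) i (leg d (inject₁ m)) ∘ₘ τᴰ (mid≤l Z m))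
                     ≈ₘ (lift (top Z (fsuc m)) i (leg d (fsuc m)) ∘ₘ σᴰ (mid≤r Z m))
    commutes m k e = begin
      map (lift (top Z (inject₁ m)) i (leg d (inject₁ m)) ∘ₘ τᴰ (mid≤l Z m)) k e
        ≡⟨ lift-τᴰ _ i (mid Z m) (mid≤l Z m) (⊓-monoˡ-≤ i (mid≤l Z m)) (leg d (inject₁ m)) k e ⟩
      liftMap (mid Z m) i (map (leg d (inject₁ m) ∘ₘ τᴰ (⊓-monoˡ-≤ i (mid≤l Z m)))) k e
        ≡⟨ liftMap-cong (mid Z m) i _ _ (comm d m) k e ⟩
      liftMap (mid Z m) i (map (leg d (fsuc m) ∘ₘ σᴰ (⊓-monoˡ-≤ i (mid≤r Z m)))) k e
        ≡⟨ sym (lift-σᴰ _ i (mid Z m) (mid≤r Z m) (⊓-monoˡ-≤ i (mid≤r Z m)) (leg d (fsuc m)) k e) ⟩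
      map (lift (top Z (fsuc m)) i (leg d (fsuc m)) ∘ₘ σᴰ (mid≤r Z m)) k e ∎

unliftCocone : ∀ {Z Y} i → Cocone Z (Degen i Y) → Cocone (trunc i Z) Y
unliftCocone {Z} {Y} i c = record { leg = λ m → unlift (top Z m) i (leg c m) ; comm = commutes }
  where
    commutes : ∀ m → (unlift (top Z (inject₁ m)) i (leg c (inject₁ m)) ∘ₘ τᴰ (⊓-monoˡ-≤ i (mid≤l Z m)))
                     ≈ₘ (unlift (top Z (fsuc m)) i (leg c (fsuc m)) ∘ₘ σᴰ (⊓-monoˡ-≤ i (mid≤r Z m)))
    commutes m k e = begin
      map (unlift (top Z (inject₁ m)) i (leg c (inject₁ m)) ∘ₘ τᴰ (⊓-monoˡ-≤ i (mid≤l Z m))) k e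
        ≡⟨ unlift-τᴰ _ i (mid Z m) (mid≤l Z m) (⊓-monoˡ-≤ i (mid≤l Z m)) (leg c (inject₁ m)) k e ⟩
      unliftMap (mid Z m) i (map (leg c (inject₁ m) ∘ₘ τᴰ (mid≤l Z m))) k e
        ≡⟨ unliftMap-cong (mid Z m) i _ _ (comm c m) k e ⟩
      unliftMap (mid Z m) i (map (leg c (fsuc m) ∘ₘ σᴰ (mid≤r Z m))) k e
        ≡⟨ sym (unlift-σᴰ _ i (mid Z m) (mid≤r Z m) (⊓-monoˡ-≤ i (mid≤r Z m)) (leg c (fsuc m)) k e) ⟩
      map (unlift (top Z (fsuc m)) i (leg c (fsuc m)) ∘ₘ σᴰ (⊓-monoˡ-≤ i (mid≤r Z m))) k e ∎

data Side : Set where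
  source target : Side

-- the end of a cell x → y that the boundary on the given side leaves out
opposite : Side → ℕ → ℕ → ℕ
opposite source x y = y
opposite target x y = x

faceᴰ : Side → ∀ {j n} → j ≤ n → D j ⇒ D n
faceᴰ source = σᴰ
faceᴰ target = τᴰ

oppositeFace : Side → (G : GSet) → ∀ k → Cell G (suc k) → Cell G k
oppositeFace source G = tgt G
oppositeFace target G = src G

oppositeFace-natural : ∀ side {G H} (h : G ⇒ H) k c →
                       map h k (oppositeFace side G k c) ≡ oppositeFace side H k (map h (suc k) c)
oppositeFace-natural source h = map-tgt h
oppositeFace-natural target h = map-src h

low⁻¹-lift-faceᴰ : ∀ side n i {Y} (p : n ⊓ i ≤ n) (d : D (n ⊓ i) ⇒ Y) k (r : k ≤ i) e →
                   low⁻¹ i Y k r (liftMap n i (map d) k (map (faceᴰ side p) k e)) ≡ map d k e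
low⁻¹-lift-faceᴰ source = low⁻¹-lift-σᴰ
low⁻¹-lift-faceᴰ target = low⁻¹-lift-τᴰ

faceᴰ-covers : ∀ side n i (p : n ⊓ i ≤ n) k (r : k ≤ i) (e : DCell n k) →
               (Σ (DCell (n ⊓ i) k) λ e′ → map (faceᴰ side p) k e′ ≡ e)
               ⊎ (k ≡ i × Σ (DCell n (suc k)) λ c → oppositeFace side (D n) k c ≡ e)
faceᴰ-covers source = σᴰ-covers
faceᴰ-covers target = τᴰ-covers

≈ₘ-id-on-colimit : ∀ {Z X c} → IsColimit Z X c →
                   (u : X ⇒ X) → (∀ m → (u ∘ₘ leg c m) ≈ₘ leg c m) → u ≈ₘ idₘ
≈ₘ-id-on-colimit {c = c} colim u u-leg n x = trans (unique u u-leg n x) (sym (unique idₘ (λ _ _ _ → refl) n x))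
  where unique = proj₂ (proj₂ (colim _ c))

module _ {Z X Y} {c : Cocone Z X} {d : Cocone Z Y} (colimX : IsColimit Z X c) (colimY : IsColimit Z Y d) where

  colimitIso : Iso X Y
  colimitIso = record { to = to′ ; from = from′ ; from∘to = from∘to′ ; to∘from = to∘from′ }
    where
      to′ : X ⇒ Y
      to′ = proj₁ (colimX Y d)
      from′ : Y ⇒ X
      from′ = proj₁ (colimY X c)
      to-leg : ∀ m → (to′ ∘ₘ leg c m) ≈ₘ leg d m
      to-leg = proj₁ (proj₂ (colimX Y d))
      from-leg : ∀ m → (from′ ∘ₘ leg d m) ≈ₘ leg c m
      from-leg = proj₁ (proj₂ (colimY X c))
      from∘to′ : (from′ ∘ₘ to′) ≈ₘ idₘ
      from∘to′ = ≈ₘ-id-on-colimit {c = c} colimX (from′ ∘ₘ to′) λ m n e →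
                   trans (cong (map from′ n) (to-leg m n e)) (from-leg m n e)
      to∘from′ : (to′ ∘ₘ from′) ≈ₘ idₘ
      to∘from′ = ≈ₘ-id-on-colimit {c = d} colimY (to′ ∘ₘ from′) λ m n e →
                   trans (cong (map to′ n) (from-leg m n e)) (to-leg m n e)

  colimitIso-leg : ∀ m → (to colimitIso ∘ₘ leg c m) ≈ₘ leg d m
  colimitIso-leg = proj₁ (proj₂ (colimX Y d))

any-DCell? : ∀ n k (P : DCell n k → Set) → (∀ e → Dec (P e)) → Dec (Σ (DCell n k) P)
any-DCell? zero    zero    P P? with P? tt
... | yes p = yes (tt , p)
... | no ¬p = no λ { (tt , p) → ¬p p }
any-DCell? zero    (suc k) P P? = no λ { (() , _) }
any-DCell? (suc n) zero    P P? with P? false | P? true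
... | yes p  | _     = yes (false , p)
... | no _   | yes p = yes (true , p)
... | no ¬p  | no ¬q = no λ { (false , p) → ¬p p ; (true , p) → ¬q p }
any-DCell? (suc n) (suc k) P P? = any-DCell? n k P P?

-- The cells hit by some leg form a sub-globular set through which every cocone leg factors;
-- by the universal property it is all of X.  Decidable equality makes membership decidable,
-- so the subset can be carried with proof-irrelevant membership witnesses.
module LegsJointlySurjective {Z X} (c : Cocone Z X) (colim : IsColimit Z X c)
  (_≟ᶜ_ : ∀ {k} (x y : Cell X k) → Dec (x ≡ y)) where

  InImage : ∀ k → Cell X k → Set
  InImage k x = Σ (Fin (suc (len Z))) λ m → Σ (DCell (top Z m) k) λ e → map (leg c m) k e ≡ x

  inImage? : ∀ k x → Dec (InImage k x)
  inImage? k x = any? λ m → any-DCell? (top Z m) k (λ e → map (leg c m) k e ≡ x) (λ e → _ ≟ᶜ x)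

  ImageCell : ℕ → Set
  ImageCell k = Σ (Cell X k) λ x → True (inImage? k x)

  imageCell-≡ : ∀ k {x y} (t : True (inImage? k x)) (t′ : True (inImage? k y)) → x ≡ y →
                _≡_ {A = ImageCell k} (x , t) (y , t′)
  imageCell-≡ k t t′ refl = cong (_ ,_) (T-irrelevant t t′)

  inImage-src : ∀ k x → InImage (suc k) x → InImage k (src X k x)
  inImage-src k x (m , e , eq) = m , dsrc (top Z m) k e , trans (map-src (leg c m) k e) (cong (src X k) eq)

  inImage-tgt : ∀ k x → InImage (suc k) x → InImage k (tgt X k x)
  inImage-tgt k x (m , e , eq) = m , dtgt (top Z m) k e , trans (map-tgt (leg c m) k e) (cong (tgt X k) eq)

  Image : GSet
  Image = record
    { Cell = ImageCell
    ; src = λ k (x , t) → src X k x , fromWitness (inImage-src k x (toWitness t))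
    ; tgt = λ k (x , t) → tgt X k x , fromWitness (inImage-tgt k x (toWitness t))
    ; glob-s = λ k c → imageCell-≡ k _ _ (glob-s X k (proj₁ c))
    ; glob-t = λ k c → imageCell-≡ k _ _ (glob-t X k (proj₁ c)) }

  imageCocone : Cocone Z Image
  imageCocone = record
    { leg = λ m → record
        { map = λ k e → map (leg c m) k e , fromWitness (m , e , refl)
        ; map-src = λ k e → imageCell-≡ k _ _ (map-src (leg c m) k e)
        ; map-tgt = λ k e → imageCell-≡ k _ _ (map-tgt (leg c m) k e) }
    ; comm = λ m k e → imageCell-≡ k _ _ (comm c m k e) }

  imageInclusion : Image ⇒ X
  imageInclusion = record { map = λ k → proj₁ ; map-src = λ k x → refl ; map-tgt = λ k x → refl }

  onto : X ⇒ Image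
  onto = proj₁ (colim Image imageCocone)

  inclusion∘onto : (imageInclusion ∘ₘ onto) ≈ₘ idₘ
  inclusion∘onto = ≈ₘ-id-on-colimit {c = c} colim (imageInclusion ∘ₘ onto) λ m n e →
                     cong proj₁ (proj₁ (proj₂ (colim Image imageCocone)) m n e)

  legs-jointly-surjective : ∀ k x → InImage k x
  legs-jointly-surjective k x with toWitness (proj₂ (map onto k x))
  ... | m , e , eq = m , e , trans eq (inclusion∘onto k x)

srcName tgtName : Ty → ℕ
srcName ⋆           = 0
srcName (Hom _ x _) = x
tgtName ⋆           = 0
tgtName (Hom _ _ y) = y

VCell-≡ : ∀ {Γ n} (c c′ : VCell Γ n) → proj₁ c ≡ proj₁ c′ → c ≡ c′
VCell-≡ {Γ} (x , A , e , d) (.x , A′ , e′ , d′) refl with trans (sym e) e′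
... | refl = cong₂ (λ e d → x , A , e , d) (uip e e′) (≡-irrelevant d d′)

_≟ᵛ_ : ∀ {Γ n} (c c′ : VCell Γ n) → Dec (c ≡ c′)
_≟ᵛ_ {Γ} c c′ with proj₁ c ≟ proj₁ c′
... | yes eq = yes (VCell-≡ {Γ} c c′ eq)
... | no ne  = no λ eq → ne (cong proj₁ eq)

vsrc-name : ∀ {Γ} (w : WF Γ) n (c : VCell Γ (suc n)) → proj₁ (vsrc {Γ} w n c) ≡ srcName (proj₁ (proj₂ c))
vsrc-name {Γ} w n (x , Hom B y z , e , refl) = refl

vtgt-name : ∀ {Γ} (w : WF Γ) n (c : VCell Γ (suc n)) → proj₁ (vtgt {Γ} w n c) ≡ tgtName (proj₁ (proj₂ c))
vtgt-name {Γ} w n (x , Hom B y z , e , refl) = refl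

oppositeFace-name : ∀ side {Γ} (w : WF Γ) n (c : VCell Γ (suc n)) →
                    proj₁ (oppositeFace side (Gwf {Γ} w) n c)
                    ≡ opposite side (srcName (proj₁ (proj₂ c))) (tgtName (proj₁ (proj₂ c)))
oppositeFace-name source {Γ} w n c = vtgt-name {Γ} w n c
oppositeFace-name target {Γ} w n c = vsrc-name {Γ} w n c

-- B ↓ i is B if dim B ≤ i, and otherwise the type of the i-dimensional iterated source of a cell of type B.
_↓_ : Ty → ℕ → Ty
⋆         ↓ i = ⋆
Hom A x y ↓ i with suc (dim A) ≤? i
... | yes _ = Hom A x y
... | no _  = A ↓ i

↓-of-dim≤ : ∀ B i → dim B ≤ i → B ↓ i ≡ B
↓-of-dim≤ ⋆           i p = refl
↓-of-dim≤ (Hom A x y) i p with suc (dim A) ≤? i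
... | yes _ = refl
... | no ¬p = ⊥-elim (¬p p)

dim-↓ : ∀ B i → i ≤ dim B → dim (B ↓ i) ≡ i
dim-↓ ⋆           zero p = refl
dim-↓ (Hom A x y) i    p with suc (dim A) ≤? i
... | yes q  = ≤-antisym q p
... | no ¬q = dim-↓ A i (≤-pred (≰⇒> ¬q))

Hom-↓ : ∀ A x y i → i ≤ dim A → Hom A x y ↓ i ≡ A ↓ i
Hom-↓ A x y i p with suc (dim A) ≤? i
... | yes q = ⊥-elim (<⇒≱ q p)
... | no _  = refl

fresh⇒nothing : ∀ {y Γ} → Fresh y Γ → typeOf Γ y ≡ nothing
fresh⇒nothing fresh-∅ = refl
fresh⇒nothing {y} (fresh-▸ {x = x} fr ne) with y ≟ x
... | yes eq = ⊥-elim (ne eq)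
... | no _   = fresh⇒nothing fr

nothing⇒fresh : ∀ {y} Γ → typeOf Γ y ≡ nothing → Fresh y Γ
nothing⇒fresh ∅           e = fresh-∅
nothing⇒fresh {y} (Γ ▸ x ∶ A) e with y ≟ x
... | yes _ with () ← e
... | no ne = fresh-▸ (nothing⇒fresh Γ e) ne

Fresh-▸-inv : ∀ {y Δ x A} → Fresh y (Δ ▸ x ∶ A) → Fresh y Δ × y ≢ x
Fresh-▸-inv (fresh-▸ fr ne) = fr , ne

typeOf-here : ∀ {Γ y A} → typeOf (Γ ▸ y ∶ A) y ≡ just A
typeOf-here {y = y} with y ≟ y
... | yes _ = refl
... | no ne = ⊥-elim (ne refl)

typeOf-there : ∀ {Γ y A z} → z ≢ y → typeOf (Γ ▸ y ∶ A) z ≡ typeOf Γ z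
typeOf-there {y = y} {z = z} ne with z ≟ y
... | yes eq = ⊥-elim (ne eq)
... | no _   = refl

declared≢fresh : ∀ {Γ y z C} → typeOf Γ z ≡ just C → Fresh y Γ → z ≢ y
declared≢fresh e fr refl with () ← trans (sym (fresh⇒nothing fr)) e

typeOf-weaken : ∀ {Γ y A z C} → Fresh y Γ → typeOf Γ z ≡ just C → typeOf (Γ ▸ y ∶ A) z ≡ just C
typeOf-weaken fr e = trans (typeOf-there (declared≢fresh e fr)) e

typeOf-weaken₂ : ∀ {Γ y A f B z C} → Fresh y Γ → Fresh f Γ → typeOf Γ z ≡ just C →
                 typeOf (Γ ▸ y ∶ A ▸ f ∶ B) z ≡ just C
typeOf-weaken₂ fy ff e = trans (typeOf-there (declared≢fresh e ff)) (typeOf-weaken fy e)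

typeOf-strengthen₂ : ∀ {Γ y A f B z} → z ≢ y → z ≢ f → typeOf (Γ ▸ y ∶ A ▸ f ∶ B) z ≡ typeOf Γ z
typeOf-strengthen₂ {Γ} {y} {A} ny nf = trans (typeOf-there nf) (typeOf-there {Γ} {y} {A} ny)

typeOf-penultimate : ∀ {Γ y A f B} → y ≢ f → typeOf (Γ ▸ y ∶ A ▸ f ∶ B) y ≡ just A
typeOf-penultimate {Γ} {y} {A} ne = trans (typeOf-there ne) (typeOf-here {Γ} {y} {A})

fresh-⊆ : ∀ {Γ Δ y} → (∀ z {B} → typeOf Δ z ≡ just B → typeOf Γ z ≡ just B) → Fresh y Γ → Fresh y Δ
fresh-⊆ {Γ} {Δ} {y} Δ⊆Γ fr with typeOf Δ y in eq
... | nothing = nothing⇒fresh Δ eq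
... | just B with () ← trans (sym (fresh⇒nothing fr)) (Δ⊆Γ y eq)

data InExtension (Γ : Ctx) (y : ℕ) (A : Ty) (f : ℕ) (B : Ty) (z : ℕ) (C : Ty) : Set where
  new-f : z ≡ f → C ≡ B → InExtension Γ y A f B z C
  new-y : z ≡ y → C ≡ A → InExtension Γ y A f B z C
  old   : z ≢ f → z ≢ y → typeOf Γ z ≡ just C → InExtension Γ y A f B z C

inExtension : ∀ {Γ y A f B} z {C} → typeOf (Γ ▸ y ∶ A ▸ f ∶ B) z ≡ just C → InExtension Γ y A f B z C
inExtension {y = y} {f = f} z e with z ≟ f
... | yes eq = new-f eq (sym (just-injective e))
... | no nf with z ≟ y
...   | yes eq = new-y eq (sym (just-injective e))
...   | no ny  = old nf ny e

data InSnoc (Γ : Ctx) (y : ℕ) (A : Ty) (z : ℕ) (C : Ty) : Set where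
  new : z ≡ y → C ≡ A → InSnoc Γ y A z C
  old : z ≢ y → typeOf Γ z ≡ just C → InSnoc Γ y A z C

inSnoc : ∀ {Γ y A} z {C} → typeOf (Γ ▸ y ∶ A) z ≡ just C → InSnoc Γ y A z C
inSnoc {y = y} z e with z ≟ y
... | yes eq = new eq (sym (just-injective e))
... | no ne  = old ne e

typeOf-start : ∀ {x z B} → typeOf (∅ ▸ x ∶ ⋆) z ≡ just B → B ≡ ⋆
typeOf-start {x} {z} e with z ≟ x | e
... | yes _ | refl = refl

⊢ps⇒PsCtx : ∀ {Γ x A} → Γ ⊢ps x ∶ A → PsCtx Γ
⊢ps⇒PsCtx {A = ⋆}         d = ps d
⊢ps⇒PsCtx {A = Hom A x y} d = ⊢ps⇒PsCtx (ps-down d)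

⊢ps-WF : ∀ {Γ x A} → Γ ⊢ps x ∶ A → WF Γ
⊢ps-WF d = psWF (⊢ps⇒PsCtx d)

⊢ps-typeOf : ∀ {Γ x A} → Γ ⊢ps x ∶ A → typeOf Γ x ≡ just A
⊢ps-typeOf (ps-start x)                          = typeOf-here {∅} {x} {⋆}
⊢ps-typeOf (ps-ext {Γ} {x} {A} {y} {f} _ _ _ _) = typeOf-here {Γ ▸ y ∶ A} {f} {Hom A x y}
⊢ps-typeOf (ps-down d)                           = proj₂ (⊢ps-WF d _ _ _ _ (⊢ps-typeOf d))

infixr 5 _⨾_

data Linked (i : ℕ) (Γ : Ctx) : ℕ → ℕ → Set where
  declared : ∀ z {B} → typeOf Γ z ≡ just B → dim B ≡ i → Linked i Γ z z
  along    : ∀ f {A x y} → typeOf Γ f ≡ just (Hom A x y) → dim A ≡ i → Linked i Γ x y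
  back     : ∀ {x y} → Linked i Γ x y → Linked i Γ y x
  _⨾_      : ∀ {x y z} → Linked i Γ x y → Linked i Γ y z → Linked i Γ x z

Linked-weaken : ∀ {i Γ Γ′} → (∀ z {B} → typeOf Γ z ≡ just B → typeOf Γ′ z ≡ just B) →
                ∀ {x y} → Linked i Γ x y → Linked i Γ′ x y
Linked-weaken w (declared z e d) = declared z (w z e) d
Linked-weaken w (along f e d)    = along f (w f e) d
Linked-weaken w (back l)         = back (Linked-weaken w l)
Linked-weaken w (l ⨾ l′)         = Linked-weaken w l ⨾ Linked-weaken w l′

-- ρ sends each variable of Γ to the variable of Δ it becomes in the i-boundary of G^Γ.
record IsBoundaryRetraction (side : Side) (i : ℕ) (Γ Δ : Ctx) (ρ : ℕ → ℕ) : Set where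
  field
    Δ⊆Γ       : ∀ z {B} → typeOf Δ z ≡ just B → typeOf Γ z ≡ just B
    dim≤      : ∀ z {B} → typeOf Δ z ≡ just B → dim B ≤ i
    typeOf-ρ  : ∀ z {B} → typeOf Γ z ≡ just B → typeOf Δ (ρ z) ≡ just (B ↓ i)
    ρ-below   : ∀ z {B} → typeOf Γ z ≡ just B → dim B < i → ρ z ≡ z
    ρ-above   : ∀ f {A x y} → typeOf Γ f ≡ just (Hom A x y) → i ≤ dim A → ρ f ≡ ρ x × ρ y ≡ ρ x
    ρ-on-Δ    : ∀ z {B} → typeOf Δ z ≡ just B → ρ z ≡ z
    ρ-linked  : ∀ z {B} → typeOf Γ z ≡ just B → dim B ≡ i → Linked i Γ z (ρ z)
    opposite∉ : ∀ f {A x y} → typeOf Γ f ≡ just (Hom A x y) → dim A ≡ i →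
                ∀ {B} → typeOf Δ (opposite side x y) ≢ just B
open IsBoundaryRetraction public

opposite-declared : ∀ side {Γ} → WF Γ → ∀ f {A x y} → typeOf Γ f ≡ just (Hom A x y) →
                    typeOf Γ (opposite side x y) ≡ just A
opposite-declared source w f e = proj₂ (w f _ _ _ e)
opposite-declared target w f e = proj₁ (w f _ _ _ e)

start-retraction : ∀ side i x → IsBoundaryRetraction side i (∅ ▸ x ∶ ⋆) (∅ ▸ x ∶ ⋆) (λ z → z)
start-retraction side i x = record
  { Δ⊆Γ       = λ _ e → e
  ; dim≤      = dim-start
  ; typeOf-ρ  = λ z {B} e → trans e (cong just (sym (↓-of-dim≤ B i (dim-start z e))))
  ; ρ-below   = λ _ _ _ → refl
  ; ρ-above   = λ f e → ⊥-elim (Hom≢⋆ (typeOf-start {x} {f} e))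
  ; ρ-on-Δ    = λ _ _ → refl
  ; ρ-linked  = declared
  ; opposite∉ = λ f e → ⊥-elim (Hom≢⋆ (typeOf-start {x} {f} e)) }
  where
    Hom≢⋆ : ∀ {A x y} → Hom A x y ≢ ⋆
    Hom≢⋆ ()
    dim-start : ∀ z {B} → typeOf (∅ ▸ x ∶ ⋆) z ≡ just B → dim B ≤ i
    dim-start z e rewrite typeOf-start {x} {z} e = z≤n

-- When i = dim A, extending Γ by y : A makes y replace the last variable of ∂⁺ i Γ; this record
-- is what keeps the result a ps-context.
record EndsWith (Δ : Ctx) (z : ℕ) (T : Ty) : Set where
  field
    prefix   : Ctx
    Δ≡       : Δ ≡ prefix ▸ z ∶ T
    z-fresh  : Fresh z prefix
    renamed  : ∀ u → Fresh u prefix → (prefix ▸ u ∶ T) ⊢ps u ∶ T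
open EndsWith public

module Extension {Γ x A y f} (d : Γ ⊢ps x ∶ A) (fy : Fresh y Γ) (ff : Fresh f Γ) (y≢f : y ≢ f) where

  Γ′ : Ctx
  Γ′ = Γ ▸ y ∶ A ▸ f ∶ Hom A x y

  wf : WF Γ
  wf = ⊢ps-WF d

  typeOf-x : typeOf Γ x ≡ just A
  typeOf-x = ⊢ps-typeOf d

  typeOf-f : typeOf Γ′ f ≡ just (Hom A x y)
  typeOf-f = typeOf-here {Γ ▸ y ∶ A} {f} {Hom A x y}

  typeOf-y : typeOf Γ′ y ≡ just A
  typeOf-y = typeOf-penultimate {Γ} y≢f

  weaken : ∀ z {C} → typeOf Γ z ≡ just C → typeOf Γ′ z ≡ just C
  weaken z = typeOf-weaken₂ {z = z} fy ff

  inΓ′ : ∀ z {C} → typeOf Γ′ z ≡ just C → InExtension Γ y A f (Hom A x y) z C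
  inΓ′ = inExtension {Γ}

  module OldVariables {side i Δ} {ρ ρ′ : ℕ → ℕ} (R : IsBoundaryRetraction side i Γ Δ ρ) (r : ℕ → ℕ)
           (ρ′-old : ∀ z {C} → typeOf Γ z ≡ just C → ρ′ z ≡ r (ρ z)) where

    ρ′-above-via : ∀ u a {A₀ x₀ y₀} → ρ′ u ≡ r (ρ a) → typeOf Γ a ≡ just (Hom A₀ x₀ y₀) → i ≤ dim A₀ →
                   ρ′ u ≡ ρ′ x₀ × ρ′ y₀ ≡ ρ′ x₀
    ρ′-above-via u a {A₀} {x₀} {y₀} ρ′u e i≤ =
        trans ρ′u (trans (cong r (proj₁ (ρ-above R a e i≤))) (sym (ρ′-old x₀ (proj₁ ends))))
      , trans (ρ′-old y₀ (proj₂ ends))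
              (trans (cong r (proj₂ (ρ-above R a e i≤))) (sym (ρ′-old x₀ (proj₁ ends))))
      where ends = wf a A₀ x₀ y₀ e

  module Collapse {side i Δ} {ρ ρ′ : ℕ → ℕ} (R : IsBoundaryRetraction side i Γ Δ ρ) (i≤A : i ≤ dim A)
    (ρ′-y : ρ′ y ≡ ρ x) (ρ′-f : ρ′ f ≡ ρ x) (ρ′-old : ∀ z {C} → typeOf Γ z ≡ just C → ρ′ z ≡ ρ z)
    (opposite∉-new : dim A ≡ i → ∀ {B} → typeOf Δ (opposite side x y) ≢ just B) where

    open OldVariables {ρ′ = ρ′} R (λ z → z) ρ′-old

    typeOf-ρ′ : ∀ z {B} → typeOf Γ′ z ≡ just B → typeOf Δ (ρ′ z) ≡ just (B ↓ i)
    typeOf-ρ′ z e with inΓ′ z e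
    ... | new-f refl refl =
      trans (cong (typeOf Δ) ρ′-f) (trans (typeOf-ρ R x typeOf-x) (cong just (sym (Hom-↓ A x y i i≤A))))
    ... | new-y refl refl = trans (cong (typeOf Δ) ρ′-y) (typeOf-ρ R x typeOf-x)
    ... | old _ _ e′ = trans (cong (typeOf Δ) (ρ′-old z e′)) (typeOf-ρ R z e′)

    ρ′-below : ∀ z {B} → typeOf Γ′ z ≡ just B → dim B < i → ρ′ z ≡ z
    ρ′-below z e B<i with inΓ′ z e
    ... | new-f refl refl = ⊥-elim (<⇒≱ (≤-trans (n≤1+n _) B<i) i≤A)
    ... | new-y refl refl = ⊥-elim (<⇒≱ B<i i≤A)
    ... | old _ _ e′ = trans (ρ′-old z e′) (ρ-below R z e′ B<i)

    ρ′-above : ∀ g {A₀ x₀ y₀} → typeOf Γ′ g ≡ just (Hom A₀ x₀ y₀) → i ≤ dim A₀ →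
               ρ′ g ≡ ρ′ x₀ × ρ′ y₀ ≡ ρ′ x₀
    ρ′-above g e i≤ with inΓ′ g e
    ... | new-f refl refl = trans ρ′-f (sym ρ′-x) , trans ρ′-y (sym ρ′-x)
      where ρ′-x = ρ′-old x typeOf-x
    ... | new-y refl refl = ρ′-above-via y x ρ′-y typeOf-x i≤
    ... | old _ _ e′ = ρ′-above-via g g (ρ′-old g e′) e′ i≤

    ρ′-linked : ∀ z {B} → typeOf Γ′ z ≡ just B → dim B ≡ i → Linked i Γ′ z (ρ′ z)
    ρ′-linked z e B≡i with inΓ′ z e
    ... | new-f refl refl = ⊥-elim (<⇒≱ (≤-reflexive B≡i) i≤A)
    ... | new-y refl refl = subst (Linked i Γ′ y) (sym ρ′-y)
                              (back (along f typeOf-f B≡i) ⨾ Linked-weaken weaken (ρ-linked R x typeOf-x B≡i))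
    ... | old _ _ e′ = subst (Linked i Γ′ z) (sym (ρ′-old z e′)) (Linked-weaken weaken (ρ-linked R z e′ B≡i))

    opposite∉′ : ∀ g {A₀ x₀ y₀} → typeOf Γ′ g ≡ just (Hom A₀ x₀ y₀) → dim A₀ ≡ i →
                 ∀ {B} → typeOf Δ (opposite side x₀ y₀) ≢ just B
    opposite∉′ g e A₀≡i with inΓ′ g e
    ... | new-f refl refl = opposite∉-new A₀≡i
    ... | new-y refl refl = opposite∉ R x typeOf-x A₀≡i
    ... | old _ _ e′ = opposite∉ R g e′ A₀≡i

    retraction : IsBoundaryRetraction side i Γ′ Δ ρ′
    retraction = record
      { Δ⊆Γ       = λ z e → weaken z (Δ⊆Γ R z e)
      ; dim≤      = dim≤ R
      ; typeOf-ρ  = typeOf-ρ′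
      ; ρ-below   = ρ′-below
      ; ρ-above   = ρ′-above
      ; ρ-on-Δ    = λ z e → trans (ρ′-old z (Δ⊆Γ R z e)) (ρ-on-Δ R z e)
      ; ρ-linked  = ρ′-linked
      ; opposite∉ = opposite∉′ }

    focus : ∀ {Θ} → Δ ≡ Θ → Δ ⊢ps ρ x ∶ A ↓ i → Θ ⊢ps ρ′ f ∶ Hom A x y ↓ i
    focus refl = subst₂ (λ z T → Δ ⊢ps z ∶ T) (sym ρ′-f) (sym (Hom-↓ A x y i i≤A))

    endsWith : ∀ {Θ} → Δ ≡ Θ → EndsWith Δ (ρ x) (A ↓ i) → EndsWith Θ (ρ′ f) (Hom A x y ↓ i)
    endsWith refl = subst₂ (EndsWith Δ) (sym ρ′-f) (sym (Hom-↓ A x y i i≤A))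

  module Append {side i Δ} {ρ ρ′ : ℕ → ℕ} (R : IsBoundaryRetraction side i Γ Δ ρ) (A<i : dim A < i)
    (ρ′-y : ρ′ y ≡ y) (ρ′-f : ρ′ f ≡ f) (ρ′-old : ∀ z {C} → typeOf Γ z ≡ just C → ρ′ z ≡ ρ z) where

    open OldVariables {ρ′ = ρ′} R (λ z → z) ρ′-old

    Δ′ : Ctx
    Δ′ = Δ ▸ y ∶ A ▸ f ∶ Hom A x y

    fyΔ : Fresh y Δ
    fyΔ = fresh-⊆ (Δ⊆Γ R) fy

    ffΔ : Fresh f Δ
    ffΔ = fresh-⊆ (Δ⊆Γ R) ff

    A↓ : A ↓ i ≡ A
    A↓ = ↓-of-dim≤ A i (<⇒≤ A<i)

    Hom↓ : Hom A x y ↓ i ≡ Hom A x y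
    Hom↓ = ↓-of-dim≤ (Hom A x y) i A<i

    Δ′⊆Γ′ : ∀ z {B} → typeOf Δ′ z ≡ just B → typeOf Γ′ z ≡ just B
    Δ′⊆Γ′ z e with inExtension {Δ} z e
    ... | new-f refl refl = typeOf-f
    ... | new-y refl refl = typeOf-y
    ... | old _ _ e′ = weaken z (Δ⊆Γ R z e′)

    dim≤′ : ∀ z {B} → typeOf Δ′ z ≡ just B → dim B ≤ i
    dim≤′ z e with inExtension {Δ} z e
    ... | new-f refl refl = A<i
    ... | new-y refl refl = <⇒≤ A<i
    ... | old _ _ e′ = dim≤ R z e′

    typeOf-ρ′ : ∀ z {B} → typeOf Γ′ z ≡ just B → typeOf Δ′ (ρ′ z) ≡ just (B ↓ i)
    typeOf-ρ′ z e with inΓ′ z e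
    ... | new-f refl refl =
      trans (cong (typeOf Δ′) ρ′-f) (trans (typeOf-here {Δ ▸ y ∶ A} {f} {Hom A x y}) (cong just (sym Hom↓)))
    ... | new-y refl refl =
      trans (cong (typeOf Δ′) ρ′-y) (trans (typeOf-penultimate {Δ} y≢f) (cong just (sym A↓)))
    ... | old _ _ e′ = trans (cong (typeOf Δ′) (ρ′-old z e′)) (typeOf-weaken₂ fyΔ ffΔ (typeOf-ρ R z e′))

    ρ′-below : ∀ z {B} → typeOf Γ′ z ≡ just B → dim B < i → ρ′ z ≡ z
    ρ′-below z e B<i with inΓ′ z e
    ... | new-f refl refl = ρ′-f
    ... | new-y refl refl = ρ′-y
    ... | old _ _ e′ = trans (ρ′-old z e′) (ρ-below R z e′ B<i)

    ρ′-above : ∀ g {A₀ x₀ y₀} → typeOf Γ′ g ≡ just (Hom A₀ x₀ y₀) → i ≤ dim A₀ →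
               ρ′ g ≡ ρ′ x₀ × ρ′ y₀ ≡ ρ′ x₀
    ρ′-above g e i≤ with inΓ′ g e
    ... | new-f refl refl = ⊥-elim (<⇒≱ A<i i≤)
    ... | new-y refl refl = ⊥-elim (<⇒≱ (≤-trans (n≤1+n _) A<i) i≤)
    ... | old _ _ e′ = ρ′-above-via g g (ρ′-old g e′) e′ i≤

    ρ′-on-Δ′ : ∀ z {B} → typeOf Δ′ z ≡ just B → ρ′ z ≡ z
    ρ′-on-Δ′ z e with inExtension {Δ} z e
    ... | new-f refl refl = ρ′-f
    ... | new-y refl refl = ρ′-y
    ... | old _ _ e′ = trans (ρ′-old z (Δ⊆Γ R z e′)) (ρ-on-Δ R z e′)

    ρ′-linked : ∀ z {B} → typeOf Γ′ z ≡ just B → dim B ≡ i → Linked i Γ′ z (ρ′ z)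
    ρ′-linked z e B≡i with inΓ′ z e
    ... | new-f refl refl = subst (Linked i Γ′ f) (sym ρ′-f) (declared f typeOf-f B≡i)
    ... | new-y refl refl = subst (Linked i Γ′ y) (sym ρ′-y) (declared y typeOf-y B≡i)
    ... | old _ _ e′ = subst (Linked i Γ′ z) (sym (ρ′-old z e′)) (Linked-weaken weaken (ρ-linked R z e′ B≡i))

    opposite∉′ : ∀ g {A₀ x₀ y₀} → typeOf Γ′ g ≡ just (Hom A₀ x₀ y₀) → dim A₀ ≡ i →
                 ∀ {B} → typeOf Δ′ (opposite side x₀ y₀) ≢ just B
    opposite∉′ g e A₀≡i with inΓ′ g e
    ... | new-f refl refl = λ _ → <⇒≢ A<i A₀≡i
    ... | new-y refl refl = λ _ → <⇒≢ (≤-trans (n≤1+n _) A<i) A₀≡i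
    ... | old _ _ e′ = λ eB → opposite∉ R g e′ A₀≡i
            (trans (sym (typeOf-strengthen₂ {Δ} {y} {A} {f} {Hom A x y} (declared≢fresh opp fy) (declared≢fresh opp ff)))
                   eB)
      where opp = opposite-declared side {Γ} wf g e′

    retraction : IsBoundaryRetraction side i Γ′ Δ′ ρ′
    retraction = record
      { Δ⊆Γ       = Δ′⊆Γ′
      ; dim≤      = dim≤′
      ; typeOf-ρ  = typeOf-ρ′
      ; ρ-below   = ρ′-below
      ; ρ-above   = ρ′-above
      ; ρ-on-Δ    = ρ′-on-Δ′
      ; ρ-linked  = ρ′-linked
      ; opposite∉ = opposite∉′ }

    ⊢x : Δ ⊢ps ρ x ∶ A ↓ i → Δ ⊢ps x ∶ A
    ⊢x = subst₂ (λ z T → Δ ⊢ps z ∶ T) (ρ-below R x typeOf-x A<i) A↓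

    focus : ∀ {Θ} → Δ′ ≡ Θ → Δ ⊢ps ρ x ∶ A ↓ i → Θ ⊢ps ρ′ f ∶ Hom A x y ↓ i
    focus refl ⊢ρx = subst₂ (λ z T → Δ′ ⊢ps z ∶ T) (sym ρ′-f) (sym Hom↓) (ps-ext (⊢x ⊢ρx) fyΔ ffΔ y≢f)

    endsWith : ∀ {Θ} → Δ′ ≡ Θ → Δ ⊢ps ρ x ∶ A ↓ i → EndsWith Θ (ρ′ f) (Hom A x y ↓ i)
    endsWith refl ⊢ρx = subst₂ (EndsWith Δ′) (sym ρ′-f) (sym Hom↓) record
      { prefix  = Δ ▸ y ∶ A
      ; Δ≡      = refl
      ; z-fresh = fresh-▸ ffΔ (λ f≡y → y≢f (sym f≡y))
      ; renamed = λ u fr → ps-ext (⊢x ⊢ρx) fyΔ (proj₁ (Fresh-▸-inv fr))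
                                  (λ y≡u → proj₂ (Fresh-▸-inv fr) (sym y≡u)) }

focus-down : ∀ {side i Γ Δ ρ f A x y} → IsBoundaryRetraction side i Γ Δ ρ → Γ ⊢ps f ∶ Hom A x y →
             Δ ⊢ps ρ f ∶ Hom A x y ↓ i → Δ ⊢ps ρ y ∶ A ↓ i
focus-down {i = i} {Δ = Δ} {ρ} {f} {A} {x} {y} R d ⊢f with i ≤? dim A
... | yes i≤A = subst₂ (λ z T → Δ ⊢ps z ∶ T) (trans (proj₁ above) (sym (proj₂ above))) (Hom-↓ A x y i i≤A) ⊢f
  where above = ρ-above R f (⊢ps-typeOf d) i≤A
... | no ¬i≤A =
  subst₂ (λ z T → Δ ⊢ps z ∶ T) (sym (ρ-below R y (⊢ps-typeOf (ps-down d)) A<i)) (sym (↓-of-dim≤ A i (<⇒≤ A<i)))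
    (ps-down (subst (λ T → Δ ⊢ps ρ f ∶ T) (↓-of-dim≤ (Hom A x y) i A<i) ⊢f))
  where A<i = ≰⇒> ¬i≤A

endsWith-down : ∀ {side i Γ Δ ρ f A x y} → IsBoundaryRetraction side i Γ Δ ρ → Γ ⊢ps f ∶ Hom A x y →
                i ≤ dim A → EndsWith Δ (ρ f) (Hom A x y ↓ i) → EndsWith Δ (ρ y) (A ↓ i)
endsWith-down {i = i} {Δ = Δ} {ρ} {f} {A} {x} {y} R d i≤A =
  subst₂ (EndsWith Δ) (trans (proj₁ above) (sym (proj₂ above))) (Hom-↓ A x y i i≤A)
  where above = ρ-above R f (⊢ps-typeOf d) i≤A

IsNew : ℕ → ℕ → ℕ → Set
IsNew y f z = z ≡ y ⊎ z ≡ f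

isNew? : ∀ y f z → Dec (IsNew y f z)
isNew? y f z = z ≟ y ⊎-dec z ≟ f

declared-old : ∀ {Γ y f z C} → Fresh y Γ → Fresh f Γ → typeOf Γ z ≡ just C → ¬ IsNew y f z
declared-old fy ff e (inj₁ z≡y) = declared≢fresh e fy z≡y
declared-old fy ff e (inj₂ z≡f) = declared≢fresh e ff z≡f

ρ⁻ : ℕ → Ctx → ℕ → ℕ
ρ⁻ i ∅                   z = z
ρ⁻ i (∅ ▸ _ ∶ _)         z = z
ρ⁻ i (Γ ▸ y ∶ A ▸ f ∶ B) z =
  if does (isNew? y f z)
  then (if does (i ≤? dim A) then ρ⁻ i Γ (srcName B) else z)
  else ρ⁻ i Γ z

module ρ⁻-Equations (i : ℕ) (Γ : Ctx) (y : ℕ) (A : Ty) (f : ℕ) (B : Ty) where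

  ρ⁻-new-collapsed : ∀ {z} → i ≤ dim A → IsNew y f z → ρ⁻ i (Γ ▸ y ∶ A ▸ f ∶ B) z ≡ ρ⁻ i Γ (srcName B)
  ρ⁻-new-collapsed {z} i≤A isNew rewrite dec-true (isNew? y f z) isNew | dec-true (i ≤? dim A) i≤A = refl

  ρ⁻-new-kept : ∀ {z} → ¬ i ≤ dim A → IsNew y f z → ρ⁻ i (Γ ▸ y ∶ A ▸ f ∶ B) z ≡ z
  ρ⁻-new-kept {z} ¬i≤A isNew rewrite dec-true (isNew? y f z) isNew | dec-false (i ≤? dim A) ¬i≤A = refl

  ρ⁻-old : ∀ {z} → ¬ IsNew y f z → ρ⁻ i (Γ ▸ y ∶ A ▸ f ∶ B) z ≡ ρ⁻ i Γ z
  ρ⁻-old {z} ¬new rewrite dec-false (isNew? y f z) ¬new = refl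

  ∂⁻-collapse : i ≤ dim A → ∂⁻ i (Γ ▸ y ∶ A ▸ f ∶ B) ≡ ∂⁻ i Γ
  ∂⁻-collapse i≤A rewrite dec-true (i ≤? dim A) i≤A = refl

  ∂⁻-append : ¬ i ≤ dim A → ∂⁻ i (Γ ▸ y ∶ A ▸ f ∶ B) ≡ (∂⁻ i Γ ▸ y ∶ A ▸ f ∶ B)
  ∂⁻-append ¬i≤A rewrite dec-false (i ≤? dim A) ¬i≤A = refl

module SourceBoundary (i : ℕ) where

  record Invariant (Γ : Ctx) (x : ℕ) (A : Ty) : Set where
    field
      focus      : ∂⁻ i Γ ⊢ps ρ⁻ i Γ x ∶ A ↓ i
      retraction : IsBoundaryRetraction source i Γ (∂⁻ i Γ) (ρ⁻ i Γ)
  open Invariant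

  extend : ∀ {Γ x A y f} (d : Γ ⊢ps x ∶ A) (fy : Fresh y Γ) (ff : Fresh f Γ) (y≢f : y ≢ f) →
           Invariant Γ x A → Invariant (Γ ▸ y ∶ A ▸ f ∶ Hom A x y) f (Hom A x y)
  extend {Γ} {x} {A} {y} {f} d fy ff y≢f I with i ≤? dim A
  ... | yes i≤A = record
    { focus      = C.focus (sym (∂⁻-collapse i≤A)) (focus I)
    ; retraction = subst (λ Δ → IsBoundaryRetraction source i Γ′ Δ (ρ⁻ i Γ′)) (sym (∂⁻-collapse i≤A))
                         C.retraction }
    where
      open Extension d fy ff y≢f
      open ρ⁻-Equations i Γ y A f (Hom A x y)
      module C = Collapse {ρ′ = ρ⁻ i Γ′} (retraction I) i≤A
                   (ρ⁻-new-collapsed i≤A (inj₁ refl)) (ρ⁻-new-collapsed i≤A (inj₂ refl))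
                   (λ z e → ρ⁻-old (declared-old fy ff e))
                   (λ _ e → declared≢fresh (Δ⊆Γ (retraction I) y e) fy refl)
  ... | no ¬i≤A = record
    { focus      = Ap.focus (sym (∂⁻-append ¬i≤A)) (focus I)
    ; retraction = subst (λ Δ → IsBoundaryRetraction source i Γ′ Δ (ρ⁻ i Γ′)) (sym (∂⁻-append ¬i≤A))
                         Ap.retraction }
    where
      open Extension d fy ff y≢f
      open ρ⁻-Equations i Γ y A f (Hom A x y)
      module Ap = Append {ρ′ = ρ⁻ i Γ′} (retraction I) (≰⇒> ¬i≤A)
                    (ρ⁻-new-kept ¬i≤A (inj₁ refl)) (ρ⁻-new-kept ¬i≤A (inj₂ refl))
                    (λ z e → ρ⁻-old (declared-old fy ff e))

  invariant : ∀ {Γ x A} → Γ ⊢ps x ∶ A → Invariant Γ x A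
  invariant (ps-start x)           = record { focus = ps-start x ; retraction = start-retraction source i x }
  invariant (ps-ext d fy ff y≢f) = extend d fy ff y≢f (invariant d)
  invariant (ps-down d)            = record { focus = focus-down (retraction I) d (focus I) ; retraction = retraction I }
    where I = invariant d

rename : ℕ → ℕ → ℕ → ℕ
rename a b z = if does (z ≟ a) then b else z

rename-≡ : ∀ a b {z} → z ≡ a → rename a b z ≡ b
rename-≡ a b {z} z≡a rewrite dec-true (z ≟ a) z≡a = refl

rename-≢ : ∀ a b {z} → z ≢ a → rename a b z ≡ z
rename-≢ a b {z} z≢a rewrite dec-false (z ≟ a) z≢a = refl

-- When i = dim A the new variable y takes the place of ρ⁺ i Γ x, the last variable of ∂⁺ i Γ.
ρ⁺ : ℕ → Ctx → ℕ → ℕ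
ρ⁺ i ∅                   z = z
ρ⁺ i (∅ ▸ _ ∶ _)         z = z
ρ⁺ i (Γ ▸ y ∶ A ▸ f ∶ B) z =
  if does (i ≟ dim A)
  then (if does (isNew? y f z) then y else rename (ρ⁺ i Γ (srcName B)) y (ρ⁺ i Γ z))
  else (if does (isNew? y f z)
        then (if does (i <? dim A) then ρ⁺ i Γ (srcName B) else z)
        else ρ⁺ i Γ z)

module ρ⁺-Equations (i : ℕ) (Γ : Ctx) (y : ℕ) (A : Ty) (f : ℕ) (B : Ty) where

  private Γ′ = Γ ▸ y ∶ A ▸ f ∶ B

  ρ⁺-new-collapsed : ∀ {z} → i < dim A → IsNew y f z → ρ⁺ i Γ′ z ≡ ρ⁺ i Γ (srcName B)
  ρ⁺-new-collapsed {z} i<A isNew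
    rewrite dec-false (i ≟ dim A) (<⇒≢ i<A) | dec-true (isNew? y f z) isNew | dec-true (i <? dim A) i<A = refl

  ρ⁺-new-kept : ∀ {z} → dim A < i → IsNew y f z → ρ⁺ i Γ′ z ≡ z
  ρ⁺-new-kept {z} A<i isNew
    rewrite dec-false (i ≟ dim A) (λ i≡A → <⇒≢ A<i (sym i≡A)) | dec-true (isNew? y f z) isNew
          | dec-false (i <? dim A) (λ i<A → <-asym i<A A<i) = refl

  ρ⁺-new-replaced : ∀ {z} → i ≡ dim A → IsNew y f z → ρ⁺ i Γ′ z ≡ y
  ρ⁺-new-replaced {z} i≡A isNew rewrite dec-true (i ≟ dim A) i≡A | dec-true (isNew? y f z) isNew = refl

  ρ⁺-old : ∀ {z} → i ≢ dim A → ¬ IsNew y f z → ρ⁺ i Γ′ z ≡ ρ⁺ i Γ z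
  ρ⁺-old {z} i≢A ¬new rewrite dec-false (i ≟ dim A) i≢A | dec-false (isNew? y f z) ¬new = refl

  ρ⁺-old-replaced : ∀ {z} → i ≡ dim A → ¬ IsNew y f z →
                    ρ⁺ i Γ′ z ≡ rename (ρ⁺ i Γ (srcName B)) y (ρ⁺ i Γ z)
  ρ⁺-old-replaced {z} i≡A ¬new rewrite dec-true (i ≟ dim A) i≡A | dec-false (isNew? y f z) ¬new = refl

  ∂⁺-collapse : i < dim A → ∂⁺ i Γ′ ≡ ∂⁺ i Γ
  ∂⁺-collapse i<A with <-cmp i (dim A)
  ... | tri< _ _ _    = refl
  ... | tri≈ ¬i<A _ _ = ⊥-elim (¬i<A i<A)
  ... | tri> ¬i<A _ _ = ⊥-elim (¬i<A i<A)

  ∂⁺-replace : i ≡ dim A → ∂⁺ i Γ′ ≡ (drop (∂⁺ i Γ) ▸ y ∶ A)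
  ∂⁺-replace i≡A with <-cmp i (dim A)
  ... | tri< _ i≢A _ = ⊥-elim (i≢A i≡A)
  ... | tri≈ _ _ _   = refl
  ... | tri> _ i≢A _ = ⊥-elim (i≢A i≡A)

  ∂⁺-append : dim A < i → ∂⁺ i Γ′ ≡ (∂⁺ i Γ ▸ y ∶ A ▸ f ∶ B)
  ∂⁺-append A<i with <-cmp i (dim A)
  ... | tri< _ _ ¬A<i = ⊥-elim (¬A<i A<i)
  ... | tri≈ _ _ ¬A<i = ⊥-elim (¬A<i A<i)
  ... | tri> _ _ _    = refl

module TargetBoundary (i : ℕ) where

  record Invariant (Γ : Ctx) (x : ℕ) (A : Ty) : Set where
    field
      focus      : ∂⁺ i Γ ⊢ps ρ⁺ i Γ x ∶ A ↓ i
      endsWith   : i ≤ dim A → EndsWith (∂⁺ i Γ) (ρ⁺ i Γ x) (A ↓ i)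
      retraction : IsBoundaryRetraction target i Γ (∂⁺ i Γ) (ρ⁺ i Γ)
  open Invariant

  module Replace {Γ x A y f} (d : Γ ⊢ps x ∶ A) (fy : Fresh y Γ) (ff : Fresh f Γ) (y≢f : y ≢ f)
                 (I : Invariant Γ x A) (i≡A : i ≡ dim A) where

    open Extension d fy ff y≢f
    open ρ⁺-Equations i Γ y A f (Hom A x y)

    R  = retraction I
    Δ  = ∂⁺ i Γ
    ρ  = ρ⁺ i Γ
    ρ′ = ρ⁺ i Γ′
    E  = endsWith I (≤-reflexive i≡A)
    Δ₀ = prefix E
    Θ  = Δ₀ ▸ y ∶ A

    A↓ : A ↓ i ≡ A
    A↓ = ↓-of-dim≤ A i (≤-reflexive (sym i≡A))

    Hom↓ : Hom A x y ↓ i ≡ A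
    Hom↓ = trans (Hom-↓ A x y i (≤-reflexive i≡A)) A↓

    ρ′-f : ρ′ f ≡ y
    ρ′-f = ρ⁺-new-replaced i≡A (inj₂ refl)

    ρ′-y : ρ′ y ≡ y
    ρ′-y = ρ⁺-new-replaced i≡A (inj₁ refl)

    ρ′-old : ∀ z {C} → typeOf Γ z ≡ just C → ρ′ z ≡ rename (ρ x) y (ρ z)
    ρ′-old z e = ρ⁺-old-replaced i≡A (declared-old fy ff e)

    ρ′-x : ρ′ x ≡ y
    ρ′-x = trans (ρ′-old x typeOf-x) (rename-≡ (ρ x) y refl)

    open OldVariables {ρ′ = ρ′} R (rename (ρ x) y) ρ′-old

    Δ₀⊆Δ : ∀ z {B} → typeOf Δ₀ z ≡ just B → typeOf Δ z ≡ just B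
    Δ₀⊆Δ z e = subst (λ Δ → typeOf Δ z ≡ just _) (sym (Δ≡ E)) (typeOf-weaken (z-fresh E) e)

    Δ-without-ρx : ∀ z {B} → typeOf Δ z ≡ just B → z ≢ ρ x → typeOf Δ₀ z ≡ just B
    Δ-without-ρx z e z≢ρx = trans (sym (typeOf-there z≢ρx)) (subst (λ Δ → typeOf Δ z ≡ just _) (Δ≡ E) e)

    fy₀ : Fresh y Δ₀
    fy₀ = proj₁ (Fresh-▸-inv (subst (Fresh y) (Δ≡ E) (fresh-⊆ (Δ⊆Γ R) fy)))

    typeOf-ρx : typeOf Δ (ρ x) ≡ just (A ↓ i)
    typeOf-ρx = typeOf-ρ R x typeOf-x

    ρz≡ρx⇒B↓≡A : ∀ z {B} → typeOf Γ z ≡ just B → ρ z ≡ ρ x → B ↓ i ≡ A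
    ρz≡ρx⇒B↓≡A z e eq =
      trans (just-injective (trans (sym (typeOf-ρ R z e)) (trans (cong (typeOf Δ) eq) typeOf-ρx))) A↓

    Θ⊆Γ′ : ∀ z {B} → typeOf Θ z ≡ just B → typeOf Γ′ z ≡ just B
    Θ⊆Γ′ z e with inSnoc {Δ₀} z e
    ... | new refl refl = typeOf-y
    ... | old _ e₀ = weaken z (Δ⊆Γ R z (Δ₀⊆Δ z e₀))

    dim≤′ : ∀ z {B} → typeOf Θ z ≡ just B → dim B ≤ i
    dim≤′ z e with inSnoc {Δ₀} z e
    ... | new refl refl = ≤-reflexive (sym i≡A)
    ... | old _ e₀ = dim≤ R z (Δ₀⊆Δ z e₀)

    typeOf-ρ′ : ∀ z {B} → typeOf Γ′ z ≡ just B → typeOf Θ (ρ′ z) ≡ just (B ↓ i)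
    typeOf-ρ′ z e with inΓ′ z e
    ... | new-f refl refl = trans (cong (typeOf Θ) ρ′-f) (trans (typeOf-here {Δ₀} {y} {A}) (cong just (sym Hom↓)))
    ... | new-y refl refl = trans (cong (typeOf Θ) ρ′-y) (trans (typeOf-here {Δ₀} {y} {A}) (cong just (sym A↓)))
    ... | old _ _ e′ with ρ z ≟ ρ x
    ...   | yes eq = trans (cong (typeOf Θ) (trans (ρ′-old z e′) (rename-≡ (ρ x) y eq)))
                       (trans (typeOf-here {Δ₀} {y} {A}) (cong just (sym (ρz≡ρx⇒B↓≡A z e′ eq))))
    ...   | no ne = trans (cong (typeOf Θ) (trans (ρ′-old z e′) (rename-≢ (ρ x) y ne)))
                       (typeOf-weaken fy₀ (Δ-without-ρx (ρ z) (typeOf-ρ R z e′) ne))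

    ρ′-below : ∀ z {B} → typeOf Γ′ z ≡ just B → dim B < i → ρ′ z ≡ z
    ρ′-below z e B<i with inΓ′ z e
    ... | new-f refl refl = ⊥-elim (<⇒≱ B<i (≤-trans (≤-reflexive i≡A) (n≤1+n _)))
    ... | new-y refl refl = ⊥-elim (<⇒≱ B<i (≤-reflexive i≡A))
    ... | old _ _ e′ = trans (ρ′-old z e′) (trans (cong (rename (ρ x) y) ρz≡z) (rename-≢ (ρ x) y z≢ρx))
      where
        ρz≡z = ρ-below R z e′ B<i
        z≢ρx : z ≢ ρ x
        z≢ρx z≡ρx = <⇒≢ B<i (trans (cong dim B≡A) (sym i≡A))
          where B≡A = trans (sym (↓-of-dim≤ _ i (<⇒≤ B<i))) (ρz≡ρx⇒B↓≡A z e′ (trans ρz≡z z≡ρx))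

    ρ′-above : ∀ g {A₀ x₀ y₀} → typeOf Γ′ g ≡ just (Hom A₀ x₀ y₀) → i ≤ dim A₀ →
               ρ′ g ≡ ρ′ x₀ × ρ′ y₀ ≡ ρ′ x₀
    ρ′-above g e i≤ with inΓ′ g e
    ... | new-f refl refl = trans ρ′-f (sym ρ′-x) , trans ρ′-y (sym ρ′-x)
    ... | new-y refl refl = ⊥-elim (<-irrefl refl (≤-trans (s≤s i≤) (≤-reflexive (sym i≡A))))
    ... | old _ _ e′ = ρ′-above-via g g (ρ′-old g e′) e′ i≤

    ρ′-on-Θ : ∀ z {B} → typeOf Θ z ≡ just B → ρ′ z ≡ z
    ρ′-on-Θ z e with inSnoc {Δ₀} z e
    ... | new refl refl = ρ′-y
    ... | old _ e₀ = trans (ρ′-old z (Δ⊆Γ R z inΔ)) (trans (cong (rename (ρ x) y) (ρ-on-Δ R z inΔ))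
                       (rename-≢ (ρ x) y (declared≢fresh e₀ (z-fresh E))))
      where inΔ = Δ₀⊆Δ z e₀

    ρ′-linked : ∀ z {B} → typeOf Γ′ z ≡ just B → dim B ≡ i → Linked i Γ′ z (ρ′ z)
    ρ′-linked z e B≡i with inΓ′ z e
    ... | new-f refl refl = ⊥-elim (1+n≢n (trans B≡i i≡A))
    ... | new-y refl refl = subst (Linked i Γ′ y) (sym ρ′-y) (declared y typeOf-y B≡i)
    ... | old _ _ e′ with ρ z ≟ ρ x
    ...   | yes eq = subst (Linked i Γ′ z) (sym (trans (ρ′-old z e′) (rename-≡ (ρ x) y eq)))
                       (Linked-weaken weaken (ρ-linked R z e′ B≡i)
                        ⨾ subst (λ u → Linked i Γ′ u x) (sym eq)
                                (back (Linked-weaken weaken (ρ-linked R x typeOf-x (sym i≡A))))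
                        ⨾ along f typeOf-f (sym i≡A))
    ...   | no ne = subst (Linked i Γ′ z) (sym (trans (ρ′-old z e′) (rename-≢ (ρ x) y ne)))
                      (Linked-weaken weaken (ρ-linked R z e′ B≡i))

    opposite∉′ : ∀ g {A₀ x₀ y₀} → typeOf Γ′ g ≡ just (Hom A₀ x₀ y₀) → dim A₀ ≡ i →
                 ∀ {B} → typeOf Θ (opposite target x₀ y₀) ≢ just B
    opposite∉′ g e A₀≡i eB with inΓ′ g e
    ... | new-y refl refl = 1+n≢n (trans (sym i≡A) (sym A₀≡i))
    ... | new-f refl refl with inSnoc {Δ₀} x eB
    ...   | new x≡y _ = declared≢fresh typeOf-x fy x≡y
    ...   | old _ e₀ = declared≢fresh e₀ (z-fresh E) (sym (ρ-on-Δ R x (Δ₀⊆Δ x e₀)))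
    opposite∉′ g {x₀ = x₀} e A₀≡i eB | old _ _ e′ with inSnoc {Δ₀} x₀ eB
    ...   | new x₀≡y _ = declared≢fresh (opposite-declared target {Γ} wf g e′) fy x₀≡y
    ...   | old _ e₀ = opposite∉ R g e′ A₀≡i (Δ₀⊆Δ x₀ e₀)

    retraction′ : IsBoundaryRetraction target i Γ′ Θ ρ′
    retraction′ = record
      { Δ⊆Γ       = Θ⊆Γ′
      ; dim≤      = dim≤′
      ; typeOf-ρ  = typeOf-ρ′
      ; ρ-below   = ρ′-below
      ; ρ-above   = ρ′-above
      ; ρ-on-Δ    = ρ′-on-Θ
      ; ρ-linked  = ρ′-linked
      ; opposite∉ = opposite∉′ }

    endsWith′ : EndsWith Θ (ρ′ f) (Hom A x y ↓ i)
    endsWith′ = subst₂ (EndsWith Θ) (sym ρ′-f) (sym (Hom-↓ A x y i (≤-reflexive i≡A))) record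
      { prefix  = Δ₀
      ; Δ≡      = cong (Δ₀ ▸ y ∶_) (sym A↓)
      ; z-fresh = fy₀
      ; renamed = renamed E }

    focus′ : Θ ⊢ps ρ′ f ∶ Hom A x y ↓ i
    focus′ = subst (λ Θ → Θ ⊢ps ρ′ f ∶ Hom A x y ↓ i) (sym (Δ≡ endsWith′))
                   (renamed endsWith′ (ρ′ f) (z-fresh endsWith′))

    Θ≡∂⁺ : Θ ≡ ∂⁺ i Γ′
    Θ≡∂⁺ = sym (trans (∂⁺-replace i≡A) (cong (λ Δ → drop Δ ▸ y ∶ A) (Δ≡ E)))

  extend : ∀ {Γ x A y f} (d : Γ ⊢ps x ∶ A) (fy : Fresh y Γ) (ff : Fresh f Γ) (y≢f : y ≢ f) →
           Invariant Γ x A → Invariant (Γ ▸ y ∶ A ▸ f ∶ Hom A x y) f (Hom A x y)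
  extend {Γ} {x} {A} {y} {f} d fy ff y≢f I with <-cmp i (dim A)
  ... | tri< i<A _ _ = record
    { focus      = C.focus (sym (∂⁺-collapse i<A)) (focus I)
    ; endsWith   = λ _ → C.endsWith (sym (∂⁺-collapse i<A)) (endsWith I (<⇒≤ i<A))
    ; retraction = subst (λ Δ → IsBoundaryRetraction target i Γ′ Δ (ρ⁺ i Γ′)) (sym (∂⁺-collapse i<A))
                         C.retraction }
    where
      open Extension d fy ff y≢f
      open ρ⁺-Equations i Γ y A f (Hom A x y)
      module C = Collapse {ρ′ = ρ⁺ i Γ′} (retraction I) (<⇒≤ i<A)
                   (ρ⁺-new-collapsed i<A (inj₁ refl)) (ρ⁺-new-collapsed i<A (inj₂ refl))
                   (λ z e → ρ⁺-old (<⇒≢ i<A) (declared-old fy ff e))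
                   (λ A≡i → ⊥-elim (<⇒≢ i<A (sym A≡i)))
  ... | tri≈ _ i≡A _ = record
    { focus      = subst (λ Δ → Δ ⊢ps ρ⁺ i Γ′ f ∶ Hom A x y ↓ i) Θ≡∂⁺ focus′
    ; endsWith   = λ _ → subst (λ Δ → EndsWith Δ (ρ⁺ i Γ′ f) (Hom A x y ↓ i)) Θ≡∂⁺ endsWith′
    ; retraction = subst (λ Δ → IsBoundaryRetraction target i Γ′ Δ (ρ⁺ i Γ′)) Θ≡∂⁺ retraction′ }
    where
      open Extension d fy ff y≢f using (Γ′)
      open Replace d fy ff y≢f I i≡A
  ... | tri> _ _ A<i = record
    { focus      = Ap.focus (sym (∂⁺-append A<i)) (focus I)
    ; endsWith   = λ _ → Ap.endsWith (sym (∂⁺-append A<i)) (focus I)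
    ; retraction = subst (λ Δ → IsBoundaryRetraction target i Γ′ Δ (ρ⁺ i Γ′)) (sym (∂⁺-append A<i))
                         Ap.retraction }
    where
      open Extension d fy ff y≢f
      open ρ⁺-Equations i Γ y A f (Hom A x y)
      module Ap = Append {ρ′ = ρ⁺ i Γ′} (retraction I) A<i
                    (ρ⁺-new-kept A<i (inj₁ refl)) (ρ⁺-new-kept A<i (inj₂ refl))
                    (λ z e → ρ⁺-old (λ i≡A → <⇒≢ A<i (sym i≡A)) (declared-old fy ff e))

  invariant : ∀ {Γ x A} → Γ ⊢ps x ∶ A → Invariant Γ x A
  invariant (ps-start x) = record
    { focus      = ps-start x
    ; endsWith   = λ _ → record { prefix = ∅ ; Δ≡ = refl ; z-fresh = fresh-∅ ; renamed = λ u _ → ps-start u }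
    ; retraction = start-retraction target i x }
  invariant (ps-ext d fy ff y≢f) = extend d fy ff y≢f (invariant d)
  invariant (ps-down {A = A} d) = record
    { focus      = focus-down (retraction I) d (focus I)
    ; endsWith   = λ i≤A → endsWith-down (retraction I) d i≤A (endsWith I (≤-trans i≤A (n≤1+n (dim A))))
    ; retraction = retraction I }
    where I = invariant d

module BoundaryColimit {side i Γ Δ} {ρ : ℕ → ℕ} (p : PsCtx Γ) (q : PsCtx Δ)
                       (R : IsBoundaryRetraction side i Γ Δ ρ) where

  private
    wΓ = psWF p
    wΔ = psWF q

  GΓ GΔ : GSet
  GΓ = G[ p ]
  GΔ = G[ q ]

  ρ-fixes-low : ∀ k (c : VCell Γ k) → k < i → ρ (proj₁ c) ≡ proj₁ c
  ρ-fixes-low k (z , B , e , refl) = ρ-below R z e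

  retractBelow : ∀ k → k ≤ i → VCell Γ k → VCell Δ k
  retractBelow k k≤i (z , B , e , d) =
    ρ z , B , trans (typeOf-ρ R z e) (cong just (↓-of-dim≤ B i (subst (_≤ i) (sym d) k≤i))) , d

  retractAbove : ∀ k → i ≤ k → VCell Γ k → VCell Δ i
  retractAbove k i≤k (z , B , e , d) = ρ z , B ↓ i , typeOf-ρ R z e , dim-↓ B i (subst (i ≤_) (sym d) i≤k)

  retractBelow-src : ∀ k (p : suc k ≤ i) (q : k ≤ i) c →
                     retractBelow k q (vsrc {Γ} wΓ k c) ≡ vsrc {Δ} wΔ k (retractBelow (suc k) p c)
  retractBelow-src k p q c = VCell-≡ {Δ} _ _
    (trans (ρ-fixes-low k (vsrc {Γ} wΓ k c) p)
           (trans (vsrc-name {Γ} wΓ k c) (sym (vsrc-name {Δ} wΔ k (retractBelow (suc k) p c)))))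

  retractBelow-tgt : ∀ k (p : suc k ≤ i) (q : k ≤ i) c →
                     retractBelow k q (vtgt {Γ} wΓ k c) ≡ vtgt {Δ} wΔ k (retractBelow (suc k) p c)
  retractBelow-tgt k p q c = VCell-≡ {Δ} _ _
    (trans (ρ-fixes-low k (vtgt {Γ} wΓ k c) p)
           (trans (vtgt-name {Γ} wΓ k c) (sym (vtgt-name {Δ} wΔ k (retractBelow (suc k) p c)))))

  retractAbove-src : ∀ k (p : i ≤ suc k) (q : i ≤ k) c →
                     retractAbove k q (vsrc {Γ} wΓ k c) ≡ retractAbove (suc k) p c
  retractAbove-src k p q c@(f , Hom A x y , e , refl) =
    VCell-≡ {Δ} _ _ (sym (proj₁ (ρ-above R f e q)))

  retractAbove-tgt : ∀ k (p : i ≤ suc k) (q : i ≤ k) c →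
                     retractAbove k q (vtgt {Γ} wΓ k c) ≡ retractAbove (suc k) p c
  retractAbove-tgt k p q c@(f , Hom A x y , e , refl) =
    VCell-≡ {Δ} _ _ (trans (proj₂ (ρ-above R f e q)) (sym (proj₁ (ρ-above R f e q))))

  retractAbove≡retractBelow : ∀ (p q : i ≤ i) c → retractAbove i p c ≡ retractBelow i q c
  retractAbove≡retractBelow p q c = VCell-≡ {Δ} _ _ refl

  open IntoDegen {GΓ} {GΔ} {i} retractBelow retractAbove retractBelow-src retractBelow-tgt
                 retractAbove-src retractAbove-tgt retractAbove≡retractBelow
    renaming (intoDegen to retraction; intoDegen-low to retraction-low)

  include : ∀ k → VCell Δ k → VCell Γ k
  include k (z , B , e , d) = z , B , Δ⊆Γ R z e , d

  inclusion : GΔ ⇒ GΓ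
  inclusion = record
    { map     = include
    ; map-src = λ k c → VCell-≡ {Γ} _ _
                          (trans (vsrc-name {Δ} wΔ k c) (sym (vsrc-name {Γ} wΓ k (include (suc k) c))))
    ; map-tgt = λ k c → VCell-≡ {Γ} _ _
                          (trans (vtgt-name {Δ} wΔ k c) (sym (vtgt-name {Γ} wΓ k (include (suc k) c)))) }

  Δ-dim≤ : ∀ k → VCell Δ k → k ≤ i
  Δ-dim≤ k (z , B , e , refl) = dim≤ R z e

  retraction∘inclusion : ∀ k (r : k ≤ i) c → map retraction k (map inclusion k c) ≡ low i GΔ k r c
  retraction∘inclusion k r c@(z , B , e , d) =
    trans (retraction-low k r _) (cong (low i GΔ k r) (VCell-≡ {Δ} _ _ (ρ-on-Δ R z e)))

  module _ {Y} (v : GΓ ⇒ Degen i Y) where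

    SameImage : ℕ → ℕ → Set
    SameImage x y = Σ (VCell Γ i) λ cx → Σ (VCell Γ i) λ cy →
                    proj₁ cx ≡ x × proj₁ cy ≡ y × map v i cx ≡ map v i cy

    -- an (i+1)-cell is sent to an identity of Degen i Y, so its source and target get the same image
    linked⇒sameImage : ∀ {x y} → Linked i Γ x y → SameImage x y
    linked⇒sameImage (declared z e d) = c , c , refl , refl , refl
      where c = z , _ , e , d
    linked⇒sameImage (along f e d) =
      vsrc {Γ} wΓ i cf , vtgt {Γ} wΓ i cf , vsrc-name {Γ} wΓ i cf , vtgt-name {Γ} wΓ i cf ,
      trans (map-src v i cf) (trans (degSrc≡degTgt i Y _) (sym (map-tgt v i cf)))
      where cf = f , _ , e , cong suc d
    linked⇒sameImage (back l) with linked⇒sameImage l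
    ... | cx , cy , ex , ey , eq = cy , cx , ey , ex , sym eq
    linked⇒sameImage (l ⨾ l′) with linked⇒sameImage l | linked⇒sameImage l′
    ... | cx , cy , ex , ey , eq | cy′ , cz , ey′ , ez , eq′ =
      cx , cz , ex , ez , trans eq (trans (cong (map v i) (VCell-≡ {Γ} cy cy′ (trans ey (sym ey′)))) eq′)

    invariant-under-ρ : ∀ k (c : VCell Γ k) (k≤i : k ≤ i) →
                        map v k (include k (retractBelow k k≤i c)) ≡ map v k c
    invariant-under-ρ k c k≤i with m≤n⇒m<n∨m≡n k≤i
    ... | inj₁ k<i = cong (map v k) (VCell-≡ {Γ} _ _ (ρ-fixes-low k c k<i))
    invariant-under-ρ .i c@(z , B , e , d) _ | inj₂ refl with linked⇒sameImage (ρ-linked R z e d)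
    ... | cx , cρ , ex , eρ , eq =
      trans (cong (map v i) (VCell-≡ {Γ} _ cρ (sym eρ)))
            (trans (sym eq) (cong (map v i) (VCell-≡ {Γ} cx _ ex)))

  low⁻¹-retraction : ∀ k (r : k ≤ i) c → low⁻¹ i GΔ k r (map retraction k c) ≡ retractBelow k r c
  low⁻¹-retraction k r c = trans (cong (low⁻¹ i GΔ k r) (retraction-low k r c)) (low⁻¹-low i GΔ k r _)

  opposite∉-cell : ∀ (c : VCell Γ (suc i)) (z : VCell Δ i) → proj₁ (oppositeFace side GΓ i c) ≢ proj₁ z
  opposite∉-cell (f , ⋆ , e , ())
  opposite∉-cell c@(f , Hom A x y , e , d) (z , C , ez , _) eq =
    opposite∉ R f e (suc-injective d)
      (subst (λ u → typeOf Δ u ≡ just C) (sym (trans (sym (oppositeFace-name side {Γ} wΓ i c)) eq)) ez)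

  module _ (P : Presentation GΓ) where

    private
      Z = diagram P
      ι = cocone P

    boundaryCocone : Cocone (trunc i Z) GΔ
    boundaryCocone = unliftCocone i (postcompose retraction ι)

    module Mediating (Y : GSet) (d : Cocone (trunc i Z) Y) where

      v : GΓ ⇒ Degen i Y
      v = proj₁ (colim P (Degen i Y) (liftCocone i d))

      v-leg : ∀ m → (v ∘ₘ leg ι m) ≈ₘ lift (top Z m) i (leg d m)
      v-leg = proj₁ (proj₂ (colim P (Degen i Y) (liftCocone i d)))

      v-unique : ∀ w → (∀ m → (w ∘ₘ leg ι m) ≈ₘ lift (top Z m) i (leg d m)) → w ≈ₘ v
      v-unique = proj₂ (proj₂ (colim P (Degen i Y) (liftCocone i d)))

      u : GΔ ⇒ Y
      u = fromDegen Δ-dim≤ (v ∘ₘ inclusion)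

      u-leg : ∀ m → (u ∘ₘ leg boundaryCocone m) ≈ₘ leg d m
      u-leg m k e = begin
        low⁻¹ i Y k _ (map v k (include k (map (leg boundaryCocone m) k e)))
          ≡⟨ low⁻¹-irrelevant i Y k _ r _ ⟩
        low⁻¹ i Y k r (map v k (include k (map (leg boundaryCocone m) k e)))
          ≡⟨ cong (λ c → low⁻¹ i Y k r (map v k (include k c)))
                  (trans (unlift-via-σᴰ (top Z m) i top⊓i≤top (retraction ∘ₘ leg ι m) k r e)
                         (low⁻¹-retraction k r _)) ⟩
        low⁻¹ i Y k r (map v k (include k (retractBelow k r (map (leg ι m) k (dσ top⊓i≤top k e)))))
          ≡⟨ cong (low⁻¹ i Y k r) (invariant-under-ρ v k _ r) ⟩
        low⁻¹ i Y k r (map v k (map (leg ι m) k (dσ top⊓i≤top k e)))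
          ≡⟨ cong (low⁻¹ i Y k r) (v-leg m k _) ⟩
        low⁻¹ i Y k r (liftMap (top Z m) i (map (leg d m)) k (dσ top⊓i≤top k e))
          ≡⟨ low⁻¹-lift-σᴰ (top Z m) i top⊓i≤top (leg d m) k r e ⟩
        map (leg d m) k e ∎
        where
          top⊓i≤top = m⊓n≤m (top Z m) i
          r = ≤-trans (DCell-dim≤ _ k e) (m⊓n≤n (top Z m) i)

      u-unique : ∀ u′ → (∀ m → (u′ ∘ₘ leg boundaryCocone m) ≈ₘ leg d m) → u′ ≈ₘ u
      u-unique u′ u′-leg k c = begin
        map u′ k c
          ≡⟨ cong (map u′ k) (sym (low⁻¹-low i GΔ k r c)) ⟩
        map u′ k (low⁻¹ i GΔ k r (low i GΔ k r c))
          ≡⟨ sym (low⁻¹-degMap i u′ k r _) ⟩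
        low⁻¹ i Y k r (degMap i u′ k (low i GΔ k r c))
          ≡⟨ cong (λ c′ → low⁻¹ i Y k r (degMap i u′ k c′)) (sym (retraction∘inclusion k r c)) ⟩
        low⁻¹ i Y k r (map (Degenₘ i u′ ∘ₘ retraction) k (include k c))
          ≡⟨ cong (low⁻¹ i Y k r) (v-unique (Degenₘ i u′ ∘ₘ retraction) w-leg k _) ⟩
        low⁻¹ i Y k r (map v k (include k c))
          ≡⟨ low⁻¹-irrelevant i Y k r _ _ ⟩
        map u k c ∎
        where
          r = Δ-dim≤ k c
          w-leg : ∀ m → ((Degenₘ i u′ ∘ₘ retraction) ∘ₘ leg ι m) ≈ₘ lift (top Z m) i (leg d m)
          w-leg m k e = begin
            degMap i u′ k (map retraction k (map (leg ι m) k e))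
              ≡⟨ cong (degMap i u′ k) (sym (lift-unlift (top Z m) i (retraction ∘ₘ leg ι m) k e)) ⟩
            degMap i u′ k (map (lift (top Z m) i (leg boundaryCocone m)) k e)
              ≡⟨ lift-natural (top Z m) i u′ (leg boundaryCocone m) k e ⟩
            liftMap (top Z m) i (map (u′ ∘ₘ leg boundaryCocone m)) k e
              ≡⟨ liftMap-cong (top Z m) i _ _ (u′-leg m) k e ⟩
            liftMap (top Z m) i (map (leg d m)) k e ∎

    boundaryCocone-isColimit : IsColimit (trunc i Z) GΔ boundaryCocone
    boundaryCocone-isColimit Y d = u , u-leg , u-unique
      where open Mediating Y d

    module _ (h : GΔ ⇒ GΓ)
             (h-leg : ∀ m → (h ∘ₘ leg boundaryCocone m) ≈ₘ (leg ι m ∘ₘ faceᴰ side (m⊓n≤m (top Z m) i))) where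

      h-on-face : ∀ m k (r : k ≤ i) (z : VCell Δ k) (e : DCell (top Z m ⊓ i) k) →
                  map (leg ι m) k (map (faceᴰ side (m⊓n≤m (top Z m) i)) k e) ≡ include k z →
                  map h k z ≡ include k z
      h-on-face m k r z e hit = begin
        map h k z
          ≡⟨ cong (map h k) (sym (low⁻¹-low i GΔ k r z)) ⟩
        map h k (low⁻¹ i GΔ k r (low i GΔ k r z))
          ≡⟨ sym (low⁻¹-degMap i h k r _) ⟩
        low⁻¹ i GΓ k r (degMap i h k (low i GΔ k r z))
          ≡⟨ cong (λ c → low⁻¹ i GΓ k r (degMap i h k c)) (sym (retraction∘inclusion k r z)) ⟩
        low⁻¹ i GΓ k r (degMap i h k (map retraction k (include k z)))
          ≡⟨ cong (λ c → low⁻¹ i GΓ k r (degMap i h k (map retraction k c))) (sym hit) ⟩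
        low⁻¹ i GΓ k r (degMap i h k (map retraction k (map (leg ι m) k fe)))
          ≡⟨ cong (λ c → low⁻¹ i GΓ k r (degMap i h k c))
                  (sym (lift-unlift (top Z m) i (retraction ∘ₘ leg ι m) k fe)) ⟩
        low⁻¹ i GΓ k r (degMap i h k (map (lift (top Z m) i (leg boundaryCocone m)) k fe))
          ≡⟨ cong (low⁻¹ i GΓ k r) (lift-natural (top Z m) i h (leg boundaryCocone m) k fe) ⟩
        low⁻¹ i GΓ k r (liftMap (top Z m) i (map (h ∘ₘ leg boundaryCocone m)) k fe)
          ≡⟨ cong (low⁻¹ i GΓ k r) (liftMap-cong (top Z m) i _ _ (h-leg m) k fe) ⟩
        low⁻¹ i GΓ k r (liftMap (top Z m) i (map (leg ι m ∘ₘ faceᴰ side top⊓i≤top)) k fe)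
          ≡⟨ low⁻¹-lift-faceᴰ side (top Z m) i top⊓i≤top (leg ι m ∘ₘ faceᴰ side top⊓i≤top) k r e ⟩
        map (leg ι m) k fe
          ≡⟨ hit ⟩
        include k z ∎
        where
          top⊓i≤top = m⊓n≤m (top Z m) i
          fe = map (faceᴰ side top⊓i≤top) k e

      open LegsJointlySurjective ι (colim P) (_≟ᵛ_ {Γ})

      -- Some leg hits z, and not at the opposite end of an (i+1)-cell of its disk, hence through faceᴰ.
      h-sendsVars : ∀ k (z : VCell Δ k) → proj₁ (map h k z) ≡ proj₁ z
      h-sendsVars k z with legs-jointly-surjective k (include k z)
      ... | m , e , hit with faceᴰ-covers side (top Z m) i (m⊓n≤m (top Z m) i) k (Δ-dim≤ k z) e
      ...   | inj₁ (e′ , refl) = cong proj₁ (h-on-face m k (Δ-dim≤ k z) z e′ hit)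
      ...   | inj₂ (refl , c , refl) =
        ⊥-elim (opposite∉-cell (map (leg ι m) (suc i) c) z
                  (cong proj₁ (trans (sym (oppositeFace-natural side (leg ι m) i c)) hit)))

    module _ (B : Boundary i P) where

      φ : Iso GΔ (obj B)
      φ = colimitIso {c = boundaryCocone} {d = bcocone B} boundaryCocone-isColimit (bcolim B)

      φ-face-sendsVars : (S : obj B ⇒ GΓ) →
                         (∀ m → (S ∘ₘ leg (bcocone B) m) ≈ₘ (leg ι m ∘ₘ faceᴰ side (m⊓n≤m (top Z m) i))) →
                         SendsVarsToThemselves {p = q} {q = p} (S ∘ₘ to φ)
      φ-face-sendsVars S S-leg = h-sendsVars (S ∘ₘ to φ) λ m k e →
        trans (cong (map S k) (colimitIso-leg {c = boundaryCocone} {d = bcocone B} boundaryCocone-isColimit (bcolim B)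
                                              m k e))
              (S-leg m k e)

mainTheorem5 : (Γ : Ctx) (p : PsCtx Γ) (i : ℕ) →
    Σ (PsCtx (∂⁻ i Γ)) λ p⁻ → Σ (PsCtx (∂⁺ i Γ)) λ p⁺ →
    (P : Presentation G[ p ]) (B : Boundary i P) →
    Σ (Iso G[ p⁻ ] (obj B)) λ φ⁻ → Σ (Iso G[ p⁺ ] (obj B)) λ φ⁺ →
      ((σG : obj B ⇒ G[ p ]) → IsBoundarySrc i P B σG →
         SendsVarsToThemselves {p = p⁻} {q = p} (σG ∘ₘ to φ⁻))
      × ((τG : obj B ⇒ G[ p ]) → IsBoundaryTgt i P B τG →
         SendsVarsToThemselves {p = p⁺} {q = p} (τG ∘ₘ to φ⁺))
mainTheorem5 Γ (ps d) i =
  p⁻ , p⁺ , λ P B → ∂⁻.φ P B , ∂⁺.φ P B , ∂⁻.φ-face-sendsVars P B , ∂⁺.φ-face-sendsVars P B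
  where
    module S = SourceBoundary i
    module T = TargetBoundary i
    I⁻ = S.invariant d
    I⁺ = T.invariant d
    p⁻ = ps (S.Invariant.focus I⁻)
    p⁺ = ps (T.Invariant.focus I⁺)
    module ∂⁻ = BoundaryColimit (ps d) p⁻ (S.Invariant.retraction I⁻)
    module ∂⁺ = BoundaryColimit (ps d) p⁺ (T.Invariant.retraction I⁺)
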